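{- Let $w\in S_n$ and $1\le i<n$. The raising crystal chute move $e_i$ is a well-defined map $RP(w)\to RP(w)\cup\{0\}$, and $\operatorname{wt}(e_i(D))=\operatorname{wt}(D)+\alpha_i$ for every $D\in RP(w)$ with $e_i(D)\neq0$, where $\alpha_i=\mathbf e_i-\mathbf e_{i+1}$ and $\mathbf e_k$ is the $k$-th standard basis vector. Moreover, for $D,D'\in RP(w)$, we have $e_i(D)=D'$ if and only if $f_i(D')=D$.
   Context: Write $w=[w_1\cdots w_n]$ with $w_i=w(i)$. Index the boxes of the $n\times n$ grid by $(i,j)$, row $i$ from the top, column $j$ from the left. Pipe dreams. A pipe dream is a covering of each box by a cross tile or an elbow tile, where crosses are only allowed in boxes with $i+j\le n$. Connecting tiles gives pipes that enter at the left of each row and exit at the top of a column: a cross lets one pipe pass horizontally and one vertically; an elbow joins the left edge to the top edge and the bottom edge to the right edge. $D$ is a pipe dream for $w$ if the pipe entering row $i$ exits from column $w_i$. It is reduced if any two pipes cross at most once. $RP(w)$ is the set of reduced pipe dreams for $w$, and $D_+$ is the set of boxes carrying crosses. The weight $\operatorname{wt}(D)\in\mathbb Z^n$ has $i$-th coordinate equal to the number of crosses in row $i$. Pairing process on row $i$. The crosses of row $i$ are considered from right to left. The cross $(i,j)$ is paired with the leftmost not-yet-paired cross of row $i+1$ lying in a column $\ge j$, if one exists; otherwise it is unpaired. Crosses of row $i+1$ never paired are unpaired. Lowering move $f_i$. Run the pairing process on row $i$. If all crosses of row $i$ are paired, set $f_i(D)=0$. Otherwise let $(i,j)$ be the leftmost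 unpaired cross of row $i$. If $(i,k)\in D_+$ for all $1\le k\le j$, set $f_i(D)=0$. Otherwise take $m\ge1$ with $(i,j-m),(i+1,j-m)\notin D_+$ and $(i,j-k),(i+1,j-k)\in D_+$ for $1\le k<m$, and set $f_i(D)_+=(D_+\setminus\{(i,j)\})\cup\{(i+1,j-m)\}$. Raising move $e_i$. Run the pairing process on row $i$. If every cross in row $i+1$ is paired, set $e_i(D)=0$. Otherwise let $(i+1,\ell)$ be the rightmost unpaired cross of row $i+1$, let $q>\ell$ be minimal with $(i+1,q)\notin D_+$, and set $e_i(D)_+=(D_+\setminus\{(i+1,\ell)\})\cup\{(i,q)\}$. -}

module Defs where

open import Data.Nat using (ℕ; zero; suc; _+_; _∸_; _≤_; _<_; _≤ᵇ_; _<ᵇ_; _≡ᵇ_)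
open import Data.Bool using (Bool; true; false; if_then_else_; _∧_)
open import Data.List using (List; []; _∷_; map; upTo; reverse; length)
open import Data.Maybe using (Maybe; just; nothing)
open import Data.Product using (_×_; _,_; proj₁; proj₂)
open import Data.Integer using (ℤ; +_; -[1+_])
open import Data.Empty using (⊥)
open import Data.Fin using (Fin; toℕ)
open import Data.Fin.Permutation using (Permutation′; _⟨$⟩ʳ_)
open import Relation.Binary.PropositionalEquality using (_≡_; _≢_)

-- Conventions: rows and columns are 1-indexed natural numbers.
-- A (candidate) pipe dream is given by its set of crosses D₊, encoded as
-- a Boolean-valued predicate on boxes (i , j) ∈ ℕ × ℕ.

Grid : Set
Grid = ℕ → ℕ → Bool

_≐_ : Grid → Grid → Set
D ≐ E = ∀ a b → D a b ≡ E a b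

cols : ℕ → List ℕ
cols n = map suc (upTo n)

filterᵇ : (ℕ → Bool) → List ℕ → List ℕ
filterᵇ p [] = []
filterᵇ p (x ∷ xs) = if p x then x ∷ filterᵇ p xs else filterᵇ p xs

rowCrosses : ℕ → Grid → ℕ → List ℕ
rowCrosses n D r = filterᵇ (D r) (cols n)

lastL : List ℕ → Maybe ℕ
lastL [] = nothing
lastL (x ∷ []) = just x
lastL (x ∷ y ∷ ys) = lastL (y ∷ ys)

data Dir : Set where
  fromLeft fromBottom : Dir

-- Returns the list of boxes visited and the column through which it exits
-- the top of the grid (nothing if it leaves the grid otherwise or the fuel
-- runs out; fuel 2n+2 always suffices since each step lowers r or raises c).
trace : ℕ → Grid → (fuel r c : ℕ) → Dir → List (ℕ × ℕ) × Maybe ℕ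
trace n D zero r c d = [] , nothing
trace n D (suc f) zero c fromBottom = [] , just c
trace n D (suc f) zero c fromLeft = [] , nothing
trace n D (suc f) (suc r) c d with n <ᵇ c
... | true = [] , nothing
... | false = ((suc r , c) ∷ proj₁ rest) , proj₂ rest
  where
  step : Bool → Dir → List (ℕ × ℕ) × Maybe ℕ
  step true  fromLeft   = trace n D f (suc r) (suc c) fromLeft
  step false fromLeft   = trace n D f r c fromBottom             -- elbow: left -> top
  step true  fromBottom = trace n D f r c fromBottom
  step false fromBottom = trace n D f (suc r) (suc c) fromLeft   -- elbow: bottom -> right
  rest = step (D (suc r) c) d

pipe : ℕ → Grid → ℕ → List (ℕ × ℕ) × Maybe ℕ
pipe n D i = trace n D (suc (suc (n + n))) i 1 fromLeft

IsPipeDream : ℕ → Grid → Set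
IsPipeDream n D = ∀ i j → D i j ≡ true → (1 ≤ i) × (1 ≤ j) × (i + j ≤ n)

IsPipeDreamFor : (n : ℕ) → Permutation′ n → Grid → Set
IsPipeDreamFor n w D =
  ∀ (k : Fin n) → proj₂ (pipe n D (suc (toℕ k))) ≡ just (suc (toℕ (w ⟨$⟩ʳ k)))

memBox : ℕ × ℕ → List (ℕ × ℕ) → Bool
memBox p [] = false
memBox (a , b) ((x , y) ∷ xs) = if (a ≡ᵇ x) ∧ (b ≡ᵇ y) then true else memBox (a , b) xs

-- number of cross tiles through which both pipes a and b pass
-- (= number of times pipes a and b cross)
crossings : ℕ → Grid → ℕ → ℕ → ℕ
crossings n D a b = length (go (proj₁ (pipe n D a)))
  where
  go : List (ℕ × ℕ) → List (ℕ × ℕ)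
  go [] = []
  go ((x , y) ∷ xs) =
    if D x y ∧ memBox (x , y) (proj₁ (pipe n D b)) then (x , y) ∷ go xs else go xs

Reduced : ℕ → Grid → Set
Reduced n D = ∀ (a b : Fin n) → a ≢ b → crossings n D (suc (toℕ a)) (suc (toℕ b)) ≤ 1

InRP : (n : ℕ) → Permutation′ n → Grid → Set
InRP n w D = IsPipeDream n D × IsPipeDreamFor n w D × Reduced n D

wt : (n : ℕ) → Grid → Fin n → ℤ
wt n D k = + length (rowCrosses n D (suc (toℕ k)))

α : (n i : ℕ) → Fin n → ℤ
α n i k = if suc (toℕ k) ≡ᵇ i then + 1
          else if suc (toℕ k) ≡ᵇ suc i then -[1+ 0 ] else + 0

takeGE : ℕ → List ℕ → Maybe (List ℕ)
takeGE j [] = nothing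
takeGE j (c ∷ cs) with j ≤ᵇ c
... | true = just cs
... | false with takeGE j cs
...   | nothing = nothing
...   | just cs' = just (c ∷ cs')

-- first argument: crosses of row i, right to left;
-- second: not-yet-paired crosses of row i+1, left to right.
-- Result: (unpaired crosses of row i, right to left ,
--          unpaired crosses of row i+1, left to right)
pairStep : List ℕ → List ℕ → List ℕ × List ℕ
pairStep [] avail = [] , avail
pairStep (j ∷ js) avail with takeGE j avail
... | just avail' = pairStep js avail'
... | nothing = (j ∷ proj₁ (pairStep js avail)) , proj₂ (pairStep js avail)

pairing : ℕ → Grid → ℕ → List ℕ × List ℕ
pairing n D i = pairStep (reverse (rowCrosses n D i)) (rowCrosses n D (suc i))

update : Grid → ℕ → ℕ → Bool → Grid
update D a b v x y = if (x ≡ᵇ a) ∧ (y ≡ᵇ b) then v else D x y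

-- Lowering move f_i  (nothing = 0)

allCross : Grid → ℕ → ℕ → Bool
allCross D i zero = true
allCross D i (suc k) = D i (suc k) ∧ allCross D i k

scanLeft : Grid → ℕ → ℕ → Maybe ℕ
scanLeft D i zero = nothing
scanLeft D i (suc c) with D i (suc c) | D (suc i) (suc c)
... | false | false = just (suc c)
... | true  | true  = scanLeft D i c
... | _     | _     = nothing

fMove : ℕ → ℕ → Grid → Maybe Grid
fMove n i D with lastL (proj₁ (pairing n D i))
... | nothing = nothing
... | just j with allCross D i j
...   | true = nothing
...   | false with scanLeft D i (j ∸ 1)
...     | nothing = nothing
...     | just c = just (update (update D i j false) (suc i) c true)

-- Raising move e_i  (nothing = 0)

findQ : Grid → ℕ → ℕ → ℕ → ℕ
findQ D r q zero = q
findQ D r q (suc f) = if D r q then findQ D r (suc q) f else q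

eMove : ℕ → ℕ → Grid → Maybe Grid
eMove n i D with lastL (proj₂ (pairing n D i))
... | nothing = nothing
... | just ℓ =
  just (update (update D (suc i) ℓ false) i (findQ D (suc i) (suc ℓ) (suc n)) true)

-- "M = D'" for a move result M ∈ {0} ∪ Grids
_↦_ : Maybe Grid → Grid → Set
nothing ↦ D' = ⊥
just E ↦ D' = E ≐ D'

{-# OPTIONS --safe #-}
-- Let ℓ be the rightmost unpaired cross of row i + 1 and q the first empty box of
-- row i + 1 right of ℓ. The pairing forces row i to be empty at ℓ and full strictly
-- between ℓ and q, and reducedness forbids a cross at (i , q): otherwise the pipes
-- entering (i + 1 , ℓ) from the left and from below would cross there and again at
-- (i , q). So e_i is a chute move. It reroutes pipes only inside the rectangle of
-- rows i, i + 1 and columns ℓ … q, which changes neither the exits nor the number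
-- of crossings of any two pipes, and it moves one cross from row i + 1 to row i.
-- Rerunning the pairing on the new rows, q is the leftmost unpaired cross of row i
-- and the scan of f_i stops at ℓ, so f_i undoes e_i. Conversely, after f_i moves
-- the cross from (i , j) to (i + 1 , c), c is the rightmost unpaired cross of
-- row i + 1 and j the first empty box right of it, so e_i undoes f_i.
module Submission where

open import Defs

module _ where

  open import Data.Bool using (Bool; true; false; if_then_else_; _∧_; _∨_; T)
  open import Data.Bool.Properties using (∧-zeroʳ; ∨-identityʳ)
  open import Data.Empty using (⊥; ⊥-elim)
  open import Data.Fin using (Fin; toℕ; fromℕ<)
  open import Data.Fin.Permutation using (Permutation′)
  open import Data.Fin.Properties using (toℕ<n; toℕ-fromℕ<)
  open import Data.Integer as ℤ using () renaming (_+_ to _+ℤ_)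
  open import Data.List using (List; []; _∷_; _++_; length; reverse; map; applyUpTo)
  open import Data.List.Membership.Propositional using (_∈_)
  open import Data.List.Membership.Propositional.Properties
    using (∈-++⁺ˡ; ∈-++⁺ʳ; ∈-++⁻; ∈-applyUpTo⁺; ∈-applyUpTo⁻)
  open import Data.List.Properties using (++-assoc; length-++; reverse-++; unfold-reverse; ∷-injectiveʳ)
  open import Data.List.Relation.Unary.All using (All; []; _∷_)
  open import Data.List.Relation.Unary.Any using (here; there)
  open import Data.List.Relation.Unary.Any.Properties using (reverse⁺; reverse⁻)
  open import Data.Maybe using (Maybe; just; nothing)
  open import Data.Maybe.Properties using (just-injective)
  open import Data.Nat using (ℕ; zero; suc; _+_; _∸_; _≤_; _<_; z≤n; s≤s; _≤ᵇ_; _<ᵇ_; _≡ᵇ_)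
  open import Data.Nat.Properties
  open import Data.Product using (Σ; _×_; _,_; proj₁; proj₂)
  open import Data.Sum using (_⊎_; inj₁; inj₂)
  open import Function using (_∘_)
  open import Relation.Binary.Definitions using (tri<; tri≈; tri>)
  open import Relation.Binary.PropositionalEquality
  open import Relation.Nullary using (¬_; Dec; yes; no)
  open import Relation.Nullary.Decidable using (_×-dec_; _⊎-dec_)

  T⇒≡true : ∀ {b} → T b → b ≡ true
  T⇒≡true {true} _ = refl

  ≡true⇒T : ∀ {b} → b ≡ true → T b
  ≡true⇒T refl = _

  ¬T⇒≡false : ∀ {b} → ¬ T b → b ≡ false
  ¬T⇒≡false {false} _ = refl
  ¬T⇒≡false {true} ¬t = ⊥-elim (¬t _)

  ≡false⇒¬T : ∀ {b} → b ≡ false → ¬ T b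
  ≡false⇒¬T refl ()

  ≡ᵇ-refl : ∀ n → (n ≡ᵇ n) ≡ true
  ≡ᵇ-refl n = T⇒≡true (≡⇒≡ᵇ n n refl)

  ≡ᵇ-true⇒ : ∀ {m n} → (m ≡ᵇ n) ≡ true → m ≡ n
  ≡ᵇ-true⇒ {m} {n} e = ≡ᵇ⇒≡ m n (≡true⇒T e)

  ≡ᵇ-false : ∀ {m n} → m ≢ n → (m ≡ᵇ n) ≡ false
  ≡ᵇ-false {m} {n} m≢n = ¬T⇒≡false (m≢n ∘ ≡ᵇ⇒≡ m n)

  <ᵇ-true : ∀ {m n} → m < n → (m <ᵇ n) ≡ true
  <ᵇ-true m<n = T⇒≡true (<⇒<ᵇ m<n)

  <ᵇ-true⇒ : ∀ {m n} → (m <ᵇ n) ≡ true → m < n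
  <ᵇ-true⇒ {m} {n} e = <ᵇ⇒< m n (≡true⇒T e)

  <ᵇ-false : ∀ {m n} → n ≤ m → (m <ᵇ n) ≡ false
  <ᵇ-false {m} {n} n≤m = ¬T⇒≡false (λ t → <⇒≱ (<ᵇ⇒< m n t) n≤m)

  <ᵇ-false⇒ : ∀ {m n} → (m <ᵇ n) ≡ false → n ≤ m
  <ᵇ-false⇒ e = ≮⇒≥ (≡false⇒¬T e ∘ <⇒<ᵇ)

  ≤ᵇ-true⇒ : ∀ {m n} → (m ≤ᵇ n) ≡ true → m ≤ n
  ≤ᵇ-true⇒ {m} {n} e = ≤ᵇ⇒≤ m n (≡true⇒T e)

  ≤ᵇ-false⇒ : ∀ {m n} → (m ≤ᵇ n) ≡ false → n < m
  ≤ᵇ-false⇒ e = ≰⇒> (≡false⇒¬T e ∘ ≤⇒≤ᵇ)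

  data Asc : List ℕ → Set where
    []  : Asc []
    _∷_ : ∀ {x xs} → (∀ {y} → y ∈ xs → x < y) → Asc xs → Asc (x ∷ xs)

  data Desc : List ℕ → Set where
    []  : Desc []
    _∷_ : ∀ {x xs} → (∀ {y} → y ∈ xs → y < x) → Desc xs → Desc (x ∷ xs)

  ∈-del : ∀ {z x : ℕ} pre {post} → z ∈ pre ++ x ∷ post → z ≢ x → z ∈ pre ++ post
  ∈-del [] (here refl) z≢x = ⊥-elim (z≢x refl)
  ∈-del [] (there p) z≢x = p
  ∈-del (_ ∷ pre) (here p) z≢x = here p
  ∈-del (_ ∷ pre) (there p) z≢x = there (∈-del pre p z≢x)

  ∈-undel : ∀ {z x : ℕ} pre {post} → z ∈ pre ++ post → z ∈ pre ++ x ∷ post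
  ∈-undel [] p = there p
  ∈-undel (_ ∷ pre) (here p) = here p
  ∈-undel (_ ∷ pre) (there p) = there (∈-undel pre p)

  Asc-++⁻ˡ : ∀ xs {ys} → Asc (xs ++ ys) → Asc xs
  Asc-++⁻ˡ [] _ = []
  Asc-++⁻ˡ (x ∷ xs) (f ∷ a) = (f ∘ ∈-++⁺ˡ) ∷ Asc-++⁻ˡ xs a

  Asc-del : ∀ pre {x : ℕ} {post} → Asc (pre ++ x ∷ post) → Asc (pre ++ post)
  Asc-del [] (_ ∷ a) = a
  Asc-del (y ∷ pre) (f ∷ a) = (f ∘ ∈-undel pre) ∷ Asc-del pre a

  Asc-∉-del : ∀ pre {x : ℕ} {post} → Asc (pre ++ x ∷ post) → x ∈ pre ++ post → ⊥
  Asc-∉-del [] (f ∷ _) p = <-irrefl refl (f p)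
  Asc-∉-del (y ∷ pre) (f ∷ _) (here refl) = <-irrefl refl (f (∈-++⁺ʳ pre (here refl)))
  Asc-∉-del (y ∷ pre) (_ ∷ a) (there p) = Asc-∉-del pre a p

  <-Asc-head : ∀ {ℓ y ys} → Asc (y ∷ ys) → ℓ < y → ∀ {z} → z ∈ y ∷ ys → ℓ < z
  <-Asc-head _ ℓ<y (here refl) = ℓ<y
  <-Asc-head (f ∷ _) ℓ<y (there p) = <-trans ℓ<y (f p)

  Desc-snoc : ∀ ys x → Desc ys → (∀ {y} → y ∈ ys → x < y) → Desc (ys ++ x ∷ [])
  Desc-snoc [] x _ _ = (λ ()) ∷ []
  Desc-snoc (y ∷ ys) x (g ∷ d) f = h ∷ Desc-snoc ys x d (f ∘ there)
    where h : ∀ {z} → z ∈ ys ++ x ∷ [] → z < y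
          h p with ∈-++⁻ ys p
          ... | inj₁ q = g q
          ... | inj₂ (here refl) = f (here refl)

  reverse-Asc : ∀ xs → Asc xs → Desc (reverse xs)
  reverse-Asc [] [] = []
  reverse-Asc (x ∷ xs) (f ∷ a) rewrite unfold-reverse x xs =
    Desc-snoc (reverse xs) x (reverse-Asc xs a) (f ∘ reverse⁻)

  reverse-middle : ∀ (xs : List ℕ) q ys → reverse (xs ++ q ∷ ys) ≡ reverse ys ++ q ∷ reverse xs
  reverse-middle xs q ys rewrite reverse-++ xs (q ∷ ys) | unfold-reverse q ys =
    ++-assoc (reverse ys) (q ∷ []) (reverse xs)

  lastL-snoc : ∀ xs (x : ℕ) → lastL (xs ++ x ∷ []) ≡ just x
  lastL-snoc [] x = refl
  lastL-snoc (y ∷ []) x = refl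
  lastL-snoc (y ∷ z ∷ zs) x = lastL-snoc (z ∷ zs) x

  lastL-∈ : ∀ xs {x : ℕ} → lastL xs ≡ just x → x ∈ xs
  lastL-∈ (y ∷ []) refl = here refl
  lastL-∈ (y ∷ z ∷ zs) e = there (lastL-∈ (z ∷ zs) e)

  lastL-max : ∀ xs {x : ℕ} → Asc xs → lastL xs ≡ just x → ∀ {y} → y ∈ xs → y ≤ x
  lastL-max (y ∷ []) _ refl (here refl) = ≤-refl
  lastL-max (y ∷ z ∷ zs) (f ∷ _) e (here refl) = <⇒≤ (f (lastL-∈ (z ∷ zs) e))
  lastL-max (y ∷ z ∷ zs) (_ ∷ a) e (there p) = lastL-max (z ∷ zs) a e p

  lastL-min : ∀ xs {x : ℕ} → Desc xs → lastL xs ≡ just x → ∀ {y} → y ∈ xs → x ≤ y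
  lastL-min (y ∷ []) _ refl (here refl) = ≤-refl
  lastL-min (y ∷ z ∷ zs) (f ∷ _) e (here refl) = <⇒≤ (f (lastL-∈ (z ∷ zs) e))
  lastL-min (y ∷ z ∷ zs) (_ ∷ d) e (there p) = lastL-min (z ∷ zs) d e p

  ≡[]-of-∉ : ∀ (xs : List ℕ) → (∀ {y} → y ∈ xs → ⊥) → xs ≡ []
  ≡[]-of-∉ [] _ = refl
  ≡[]-of-∉ (x ∷ xs) f = ⊥-elim (f (here refl))

  -- The pairing process

  unpairedUpper unpairedLower : List ℕ → List ℕ → List ℕ
  unpairedUpper us av = proj₁ (pairStep us av)
  unpairedLower us av = proj₂ (pairStep us av)

  record Taken (u : ℕ) (av av′ : List ℕ) : Set where
    constructor taken
    field
      pre  : List ℕ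
      x    : ℕ
      post : List ℕ
      av≡  : av ≡ pre ++ x ∷ post
      av′≡ : av′ ≡ pre ++ post
      pre<u : ∀ {y} → y ∈ pre → y < u
      u≤x  : u ≤ x

  takeGE-just : ∀ u av {av′} → takeGE u av ≡ just av′ → Taken u av av′
  takeGE-just u (c ∷ cs) eq with u ≤ᵇ c in u≤ᵇc
  ... | true = taken [] c cs refl (sym (just-injective eq)) (λ ()) (≤ᵇ-true⇒ u≤ᵇc)
  ... | false with takeGE u cs in eq′
  ...   | just cs′ with takeGE-just u cs eq′
  ...     | taken pre x post refl refl pre<u u≤x =
    taken (c ∷ pre) x post refl (sym (just-injective eq)) c∷pre<u u≤x
    where c∷pre<u : ∀ {y} → y ∈ c ∷ pre → y < u
          c∷pre<u (here refl) = ≤ᵇ-false⇒ u≤ᵇc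
          c∷pre<u (there p) = pre<u p

  takeGE-nothing : ∀ u av → takeGE u av ≡ nothing → ∀ {y} → y ∈ av → y < u
  takeGE-nothing u (c ∷ cs) eq p with u ≤ᵇ c in u≤ᵇc
  ... | false with takeGE u cs in eq′
  takeGE-nothing u (c ∷ cs) eq (here refl) | false | nothing = ≤ᵇ-false⇒ u≤ᵇc
  takeGE-nothing u (c ∷ cs) eq (there p)   | false | nothing = takeGE-nothing u cs eq′ p

  module _ {u av av′} (A : Asc av) (t : Taken u av av′) where
    open Taken t

    taken-Asc : Asc av′
    taken-Asc rewrite av′≡ = Asc-del pre (subst Asc av≡ A)

    taken-⊆ : ∀ {z} → z ∈ av′ → z ∈ av
    taken-⊆ p rewrite av≡ | av′≡ = ∈-undel pre p

    taken-x∈ : x ∈ av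
    taken-x∈ rewrite av≡ = ∈-++⁺ʳ pre (here refl)

    taken-x∉ : x ∈ av′ → ⊥
    taken-x∉ p rewrite av′≡ = Asc-∉-del pre (subst Asc av≡ A) p

    taken-keep : ∀ {z} → z ∈ av → z ≢ x → z ∈ av′
    taken-keep p z≢x rewrite av′≡ | av≡ = ∈-del pre p z≢x

    taken-min : ∀ {w} → w ∈ av → u ≤ w → x ≤ w
    taken-min p u≤w rewrite av≡ with ∈-++⁻ pre p
    ... | inj₁ q = ⊥-elim (<⇒≱ (pre<u q) u≤w)
    ... | inj₂ (here refl) = ≤-refl
    ... | inj₂ (there q) = <⇒≤ (x<post pre (subst Asc av≡ A) q)
      where x<post : ∀ pre {v} → Asc (pre ++ x ∷ post) → v ∈ post → x < v
            x<post [] (f ∷ _) q = f q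
            x<post (_ ∷ pre) (_ ∷ a) q = x<post pre a q

    taken-keepBelow : ∀ {z} → z ∈ av → z < u → z ∈ av′
    taken-keepBelow p z<u = taken-keep p (λ { refl → <⇒≱ z<u u≤x })

    taken-keepAbove : ∀ {w z} → w ∈ av → u ≤ w → z ∈ av → w < z → z ∈ av′
    taken-keepAbove pw u≤w pz w<z = taken-keep pz (λ { refl → <⇒≱ w<z (taken-min pw u≤w) })

  pairStep-paired : ∀ u us av {av′} → takeGE u av ≡ just av′ → pairStep (u ∷ us) av ≡ pairStep us av′
  pairStep-paired u us av e rewrite e = refl

  pairStep-unpaired : ∀ u us av → takeGE u av ≡ nothing →
    pairStep (u ∷ us) av ≡ (u ∷ unpairedUpper us av , unpairedLower us av)
  pairStep-unpaired u us av e rewrite e = refl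

  pairStep-++ : ∀ xs ys av → pairStep (xs ++ ys) av ≡
    (unpairedUpper xs av ++ unpairedUpper ys (unpairedLower xs av) , unpairedLower ys (unpairedLower xs av))
  pairStep-++ [] ys av = refl
  pairStep-++ (x ∷ xs) ys av with takeGE x av
  ... | just av′ = pairStep-++ xs ys av′
  ... | nothing rewrite pairStep-++ xs ys av = refl

  unpairedLower-⊆ : ∀ us av → Asc av → ∀ {y} → y ∈ unpairedLower us av → y ∈ av
  unpairedLower-⊆ [] av A p = p
  unpairedLower-⊆ (u ∷ us) av A p with takeGE u av in e
  ... | just av′ = let t = takeGE-just u av e in taken-⊆ A t (unpairedLower-⊆ us av′ (taken-Asc A t) p)
  ... | nothing = unpairedLower-⊆ us av A p

  unpairedLower-Asc : ∀ us av → Asc av → Asc (unpairedLower us av)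
  unpairedLower-Asc [] av A = A
  unpairedLower-Asc (u ∷ us) av A with takeGE u av in e
  ... | just av′ = unpairedLower-Asc us av′ (taken-Asc A (takeGE-just u av e))
  ... | nothing = unpairedLower-Asc us av A

  unpairedUpper-⊆ : ∀ us av → ∀ {y} → y ∈ unpairedUpper us av → y ∈ us
  unpairedUpper-⊆ (u ∷ us) av p with takeGE u av
  ... | just av′ = there (unpairedUpper-⊆ us av′ p)
  unpairedUpper-⊆ (u ∷ us) av (here e) | nothing = here e
  unpairedUpper-⊆ (u ∷ us) av (there p) | nothing = there (unpairedUpper-⊆ us av p)

  unpairedUpper-Desc : ∀ us av → Desc us → Desc (unpairedUpper us av)
  unpairedUpper-Desc [] av _ = []
  unpairedUpper-Desc (u ∷ us) av (f ∷ D) with takeGE u av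
  ... | just av′ = unpairedUpper-Desc us av′ D
  ... | nothing = (f ∘ unpairedUpper-⊆ us av) ∷ unpairedUpper-Desc us av D

  unpairedLower-keepsBelow : ∀ us av z → Asc av → (∀ {u} → u ∈ us → z < u) → z ∈ av → z ∈ unpairedLower us av
  unpairedLower-keepsBelow [] av z A f p = p
  unpairedLower-keepsBelow (u ∷ us) av z A f p with takeGE u av in e
  ... | just av′ = let t = takeGE-just u av e in
    unpairedLower-keepsBelow us av′ z (taken-Asc A t) (f ∘ there) (taken-keepBelow A t p (f (here refl)))
  ... | nothing = unpairedLower-keepsBelow us av z A (f ∘ there) p

  insA : ℕ → List ℕ → List ℕ
  insA c [] = c ∷ []
  insA c (x ∷ xs) = if c <ᵇ x then c ∷ x ∷ xs else x ∷ insA c xs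

  insA-< : ∀ {ℓ y} ys → (ℓ <ᵇ y) ≡ true → insA ℓ (y ∷ ys) ≡ ℓ ∷ y ∷ ys
  insA-< ys e rewrite e = refl

  insA-≥ : ∀ {ℓ y} ys → (ℓ <ᵇ y) ≡ false → insA ℓ (y ∷ ys) ≡ y ∷ insA ℓ ys
  insA-≥ ys e rewrite e = refl

  insA-∈⁻ : ∀ {z} c xs → z ∈ insA c xs → z ≡ c ⊎ z ∈ xs
  insA-∈⁻ c [] (here e) = inj₁ e
  insA-∈⁻ c (x ∷ xs) p with c <ᵇ x
  insA-∈⁻ c (x ∷ xs) (here e) | true = inj₁ e
  insA-∈⁻ c (x ∷ xs) (there p) | true = inj₂ p
  insA-∈⁻ c (x ∷ xs) (here e) | false = inj₂ (here e)
  insA-∈⁻ c (x ∷ xs) (there p) | false with insA-∈⁻ c xs p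
  ... | inj₁ e = inj₁ e
  ... | inj₂ q = inj₂ (there q)

  insA-∈⁺ : ∀ {z} c xs → z ∈ xs → z ∈ insA c xs
  insA-∈⁺ c (x ∷ xs) p with c <ᵇ x
  ... | true = there p
  insA-∈⁺ c (x ∷ xs) (here e) | false = here e
  insA-∈⁺ c (x ∷ xs) (there p) | false = there (insA-∈⁺ c xs p)

  insA-min : ∀ c xs → (∀ {y} → y ∈ xs → c < y) → insA c xs ≡ c ∷ xs
  insA-min c [] f = refl
  insA-min c (x ∷ xs) f rewrite <ᵇ-true (f (here refl)) = refl

  insA-max : ∀ c xs → (∀ {y} → y ∈ xs → y < c) → insA c xs ≡ xs ++ c ∷ []
  insA-max c [] f = refl
  insA-max c (x ∷ xs) f rewrite <ᵇ-false {c} {x} (<⇒≤ (f (here refl))) =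
    cong (x ∷_) (insA-max c xs (f ∘ there))

  insA-Asc : ∀ c xs → Asc xs → (c ∈ xs → ⊥) → Asc (insA c xs)
  insA-Asc c [] [] c∉ = (λ ()) ∷ []
  insA-Asc c (x ∷ xs) (f ∷ A) c∉ with c <ᵇ x in e
  ... | true = <-Asc-head (f ∷ A) (<ᵇ-true⇒ e) ∷ (f ∷ A)
  ... | false = x<ins ∷ insA-Asc c xs A (c∉ ∘ there)
    where x<ins : ∀ {y} → y ∈ insA c xs → x < y
          x<ins p with insA-∈⁻ c xs p
          ... | inj₂ q = f q
          ... | inj₁ refl = ≤∧≢⇒< (<ᵇ-false⇒ e) (λ x≡c → c∉ (here (sym x≡c)))

  length-insA : ∀ c xs → length (insA c xs) ≡ suc (length xs)
  length-insA c [] = refl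
  length-insA c (x ∷ xs) with c <ᵇ x
  ... | true = refl
  ... | false = cong suc (length-insA c xs)

  record Split (q : ℕ) (X : List ℕ) : Set where
    constructor split
    field
      lo hi : List ℕ
      X≡    : X ≡ lo ++ hi
      lo<q  : ∀ {y} → y ∈ lo → y < q
      q<hi  : ∀ {y} → y ∈ hi → q < y
      insA≡ : insA q X ≡ lo ++ q ∷ hi

  splitAt : ∀ q X → Asc X → (q ∈ X → ⊥) → Split q X
  splitAt q [] [] q∉ = split [] [] refl (λ ()) (λ ()) refl
  splitAt q (x ∷ xs) (f ∷ A) q∉ with q <ᵇ x in q<ᵇx
  ... | true = split [] (x ∷ xs) refl (λ ()) (<-Asc-head (f ∷ A) (<ᵇ-true⇒ q<ᵇx)) (insA-< xs q<ᵇx)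
  ... | false with splitAt q xs A (q∉ ∘ there)
  ...   | split lo hi X≡ lo<q q<hi insA≡ =
    split (x ∷ lo) hi (cong (x ∷_) X≡) x∷lo<q q<hi (trans (insA-≥ xs q<ᵇx) (cong (x ∷_) insA≡))
    where x∷lo<q : ∀ {y} → y ∈ x ∷ lo → y < q
          x∷lo<q (here refl) = ≤∧≢⇒< (<ᵇ-false⇒ q<ᵇx) (λ x≡q → q∉ (here (sym x≡q)))
          x∷lo<q (there p) = lo<q p

  data TakeGE-insA (u ℓ : ℕ) (Y : List ℕ) : List ℕ → Set where
    commutes : ∀ {Z} → takeGE u Z ≡ Data.Maybe.map (insA ℓ) (takeGE u Y) → TakeGE-insA u ℓ Y Z
    takes-ℓ  : ∀ {Z} → takeGE u Z ≡ just Y → u ≤ ℓ → (∀ {y} → y ∈ Y → u ≤ y → ℓ < y) → TakeGE-insA u ℓ Y Z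

  takeGE-head : ∀ u c cs → (u ≤ᵇ c) ≡ true → takeGE u (c ∷ cs) ≡ just cs
  takeGE-head u c cs e rewrite e = refl

  takeGE-skip : ∀ u c cs → (u ≤ᵇ c) ≡ false → takeGE u (c ∷ cs) ≡ Data.Maybe.map (c ∷_) (takeGE u cs)
  takeGE-skip u c cs e rewrite e with takeGE u cs
  ... | nothing = refl
  ... | just _ = refl

  takeGE-insA-< : ∀ u ℓ y ys → Asc (y ∷ ys) → (ℓ <ᵇ y) ≡ true → TakeGE-insA u ℓ (y ∷ ys) (ℓ ∷ y ∷ ys)
  takeGE-insA-< u ℓ y ys A ℓ<ᵇy with u ≤ᵇ ℓ in u≤ᵇℓ
  ... | true = takes-ℓ (takeGE-head u ℓ (y ∷ ys) u≤ᵇℓ) (≤ᵇ-true⇒ u≤ᵇℓ) (λ p _ → <-Asc-head A (<ᵇ-true⇒ ℓ<ᵇy) p)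
  ... | false = commutes (trans (takeGE-skip u ℓ (y ∷ ys) u≤ᵇℓ) (map-∷≡map-insA (takeGE u (y ∷ ys)) refl))
    where
    map-∷≡map-insA : ∀ r → takeGE u (y ∷ ys) ≡ r → Data.Maybe.map (ℓ ∷_) r ≡ Data.Maybe.map (insA ℓ) r
    map-∷≡map-insA nothing _ = refl
    map-∷≡map-insA (just r) e = cong just (sym (insA-min ℓ r
      (<-Asc-head A (<ᵇ-true⇒ ℓ<ᵇy) ∘ taken-⊆ A (takeGE-just u (y ∷ ys) e))))

  takeGE-insA-≥ : ∀ u ℓ y ys → (ℓ <ᵇ y) ≡ false → TakeGE-insA u ℓ ys (insA ℓ ys) →
    TakeGE-insA u ℓ (y ∷ ys) (y ∷ insA ℓ ys)
  takeGE-insA-≥ u ℓ y ys ℓ≥y rec with u ≤ᵇ y in u≤ᵇy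
  ... | true = commutes (trans (takeGE-head u y (insA ℓ ys) u≤ᵇy) (cong (Data.Maybe.map (insA ℓ)) (sym (takeGE-head u y ys u≤ᵇy))))
  ... | false with rec
  ...   | takes-ℓ eq u≤ℓ big = takes-ℓ (trans (takeGE-skip u y (insA ℓ ys) u≤ᵇy) (cong (Data.Maybe.map (y ∷_)) eq)) u≤ℓ big′
    where big′ : ∀ {z} → z ∈ y ∷ ys → u ≤ z → ℓ < z
          big′ (here refl) u≤y = ⊥-elim (<⇒≱ (≤ᵇ-false⇒ u≤ᵇy) u≤y)
          big′ (there p) u≤z = big p u≤z
  ...   | commutes eq = commutes (trans (takeGE-skip u y (insA ℓ ys) u≤ᵇy)
                          (trans (cong (Data.Maybe.map (y ∷_)) eq) (trans (map-insA (takeGE u ys))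
                          (cong (Data.Maybe.map (insA ℓ)) (sym (takeGE-skip u y ys u≤ᵇy))))))
    where map-insA : ∀ r → Data.Maybe.map (y ∷_) (Data.Maybe.map (insA ℓ) r) ≡ Data.Maybe.map (insA ℓ) (Data.Maybe.map (y ∷_) r)
          map-insA nothing = refl
          map-insA (just r) = cong just (sym (insA-≥ r ℓ≥y))

  takeGE-insA : ∀ u ℓ Y → Asc Y → (ℓ ∈ Y → ⊥) → TakeGE-insA u ℓ Y (insA ℓ Y)
  takeGE-insA u ℓ [] _ _ with u ≤ᵇ ℓ in u≤ᵇℓ
  ... | true = takes-ℓ (takeGE-head u ℓ [] u≤ᵇℓ) (≤ᵇ-true⇒ u≤ᵇℓ) (λ ())
  ... | false = commutes (takeGE-skip u ℓ [] u≤ᵇℓ)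
  takeGE-insA u ℓ (y ∷ ys) (f ∷ A) ℓ∉ with ℓ <ᵇ y in ℓ<ᵇy
  ... | true = takeGE-insA-< u ℓ y ys (f ∷ A) ℓ<ᵇy
  ... | false = takeGE-insA-≥ u ℓ y ys ℓ<ᵇy (takeGE-insA u ℓ ys A (ℓ∉ ∘ there))

  unpaired-or-below-tail : ∀ {ℓ u us} {X X′ : List ℕ} → X ≡ X′ →
    ℓ ∈ X ⊎ (∀ {v} → v ∈ u ∷ us → ℓ < v) → ℓ ∈ X′ ⊎ (∀ {v} → v ∈ us → ℓ < v)
  unpaired-or-below-tail refl (inj₁ p) = inj₁ p
  unpaired-or-below-tail _ (inj₂ big) = inj₂ (big ∘ there)

  -- The last hypothesis says that ℓ is never taken: it ends unpaired, or it lies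
  -- left of every upper cross.
  pairStep-insA : ∀ us ℓ Y → Asc Y → (ℓ ∈ Y → ⊥) →
    (ℓ ∈ unpairedLower us (insA ℓ Y) ⊎ (∀ {u} → u ∈ us → ℓ < u)) →
    pairStep us (insA ℓ Y) ≡ (unpairedUpper us Y , insA ℓ (unpairedLower us Y))
  pairStep-insA [] ℓ Y A ℓ∉ _ = refl
  pairStep-insA (u ∷ us) ℓ Y A ℓ∉ ℓ-unpaired with takeGE-insA u ℓ Y A ℓ∉ | ℓ-unpaired
  ... | takes-ℓ eq u≤ℓ _ | inj₂ ℓ<us = ⊥-elim (<⇒≱ (ℓ<us (here refl)) u≤ℓ)
  ... | takes-ℓ eq u≤ℓ _ | inj₁ ℓ∈
        rewrite pairStep-paired u us (insA ℓ Y) eq = ⊥-elim (ℓ∉ (unpairedLower-⊆ us Y A ℓ∈))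
  ... | commutes eq | _ with takeGE u Y in e
  ...   | just Y′ = trans step (pairStep-insA us ℓ Y′ (taken-Asc A t) (ℓ∉ ∘ taken-⊆ A t)
                                 (unpaired-or-below-tail (cong proj₂ step) ℓ-unpaired))
    where t = takeGE-just u Y e
          step = pairStep-paired u us (insA ℓ Y) eq
  ...   | nothing = trans step (cong (λ r → u ∷ proj₁ r , proj₂ r) (pairStep-insA us ℓ Y A ℓ∉
                                 (unpaired-or-below-tail (cong proj₂ step) ℓ-unpaired)))
    where step = pairStep-unpaired u us (insA ℓ Y) eq

  record ReverseSplit (q : ℕ) (X : List ℕ) : Set where
    field
      above below : List ℕ
      reverse≡      : reverse X ≡ above ++ below
      reverse-insA≡ : reverse (insA q X) ≡ above ++ q ∷ below
      q<above : ∀ {y} → y ∈ above → q < y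
      below<q : ∀ {y} → y ∈ below → y < q
      below-Desc : Desc below
      below-⊆ : ∀ {y} → y ∈ below → y ∈ X

  reverseSplit : ∀ q X → Asc X → (q ∈ X → ⊥) → ReverseSplit q X
  reverseSplit q X A q∉ = record
    { above = reverse hi
    ; below = reverse lo
    ; reverse≡ = trans (cong reverse X≡) (reverse-++ lo hi)
    ; reverse-insA≡ = trans (cong reverse insA≡) (reverse-middle lo q hi)
    ; q<above = q<hi ∘ reverse⁻
    ; below<q = lo<q ∘ reverse⁻
    ; below-Desc = reverse-Asc lo (Asc-++⁻ˡ lo (subst Asc X≡ A))
    ; below-⊆ = λ p → subst (_ ∈_) (sym X≡) (∈-++⁺ˡ {ys = hi} (reverse⁻ p))
    }
    where open Split (splitAt q X A q∉)

  -- A cross of the upper row above ℓ would have taken ℓ or a cross left of it.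
  unpairedLower∉upper : ∀ us av ℓ → Asc av → ℓ ∈ unpairedLower us av → ℓ ∈ us → ⊥
  unpairedLower∉upper (u ∷ us) av ℓ A p q with takeGE u av in e | q
  ... | just av′ | there q′ = unpairedLower∉upper us av′ ℓ (taken-Asc A (takeGE-just u av e)) p q′
  ... | just av′ | here refl = taken-x∉ A t (subst (_∈ av′) (sym x≡ℓ) ℓ∈av′)
    where
    t = takeGE-just u av e
    ℓ∈av′ = unpairedLower-⊆ us av′ (taken-Asc A t) p
    x≡ℓ = ≤-antisym (taken-min A t (taken-⊆ A t ℓ∈av′) ≤-refl) (Taken.u≤x t)
  ... | nothing | there q′ = unpairedLower∉upper us av ℓ A p q′
  ... | nothing | here refl = <-irrefl refl (takeGE-nothing u av e (unpairedLower-⊆ us av A p))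

  -- Lower crosses strictly between ℓ and q that are still available when the
  -- pairing reaches the upper crosses left of b.
  module Gap (ℓ q : ℕ) where

    Available : ℕ → List ℕ → Set
    Available b av = ∀ {z} → ℓ < z → z < q → z < b → z ∈ av

    available-paired : ∀ {u av av′ b} → Asc av → takeGE u av ≡ just av′ → u < b →
      Available b av → Available u av′
    available-paired {u} {av} A e u<b full ℓ<z z<q z<u =
      taken-keepBelow A (takeGE-just u av e) (full ℓ<z z<q (<-trans z<u u<b)) z<u

    available-unpaired : ∀ {u av b} → u < b → Available b av → Available u av
    available-unpaired u<b full ℓ<z z<q z<u = full ℓ<z z<q (<-trans z<u u<b)

    -- The upper crosses left of q cannot take a lower cross right of ℓ
    -- without first taking ℓ itself.
    unpairedLower-keeps : ∀ us av b z → Desc us → Asc av → (∀ {u} → u ∈ us → u < b) →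
      Available b av → ℓ ∈ unpairedLower us av → z ∈ av → ℓ < z →
      (∀ {u} → u ∈ us → u < z) → (∀ {u} → u ∈ us → u < q) → z ∈ unpairedLower us av
    unpairedLower-keeps [] av b z _ _ _ _ _ z∈ _ _ _ = z∈
    unpairedLower-keeps (u ∷ us) av b z (f ∷ D) A us<b full ℓ∈ z∈ ℓ<z us<z us<q with takeGE u av in e
    ... | just av′ =
      unpairedLower-keeps us av′ u z D (taken-Asc A t) f (available-paired A e (us<b (here refl)) full) ℓ∈
        z∈av′ ℓ<z (us<z ∘ there) (us<q ∘ there)
      where
      t = takeGE-just u av e
      z∈av′ : z ∈ av′
      z∈av′ with u ≤? ℓ
      ... | yes u≤ℓ = taken-keepAbove A t (taken-⊆ A t (unpairedLower-⊆ us av′ (taken-Asc A t) ℓ∈)) u≤ℓ z∈ ℓ<z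
      ... | no u≰ℓ = taken-keepAbove A t (full (≰⇒> u≰ℓ) (us<q (here refl)) (us<b (here refl))) ≤-refl z∈
                       (us<z (here refl))
    ... | nothing =
      unpairedLower-keeps us av u z D A f (available-unpaired (us<b (here refl)) full) ℓ∈ z∈ ℓ<z
        (us<z ∘ there) (us<q ∘ there)

    allUpperPaired : ∀ us av b → Desc us → Asc av → (∀ {u} → u ∈ us → u < b) → Available b av →
      ℓ ∈ unpairedLower us av → (∀ {u} → u ∈ us → u < q) → unpairedUpper us av ≡ []
    allUpperPaired [] av b _ _ _ _ _ _ = refl
    allUpperPaired (u ∷ us) av b (f ∷ D) A us<b full ℓ∈ us<q with takeGE u av in e
    ... | just av′ = allUpperPaired us av′ u D (taken-Asc A (takeGE-just u av e)) f
                       (available-paired A e (us<b (here refl)) full) ℓ∈ (us<q ∘ there)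
    ... | nothing with u ≤? ℓ
    ...   | yes u≤ℓ = ⊥-elim (<⇒≱ (takeGE-nothing u av e (unpairedLower-⊆ us av A ℓ∈)) u≤ℓ)
    ...   | no u≰ℓ = ⊥-elim (<-irrefl refl (takeGE-nothing u av e
                       (full (≰⇒> u≰ℓ) (us<q (here refl)) (us<b (here refl)))))

    upper-full : ∀ us av b → Desc us → Asc av → (∀ {u} → u ∈ us → u < b) → Available b av →
      ℓ ∈ unpairedLower us av → (∀ {y} → y ∈ unpairedLower us av → y ≤ ℓ) →
      ∀ {z} → ℓ < z → z < q → z < b → z ∈ us
    upper-full [] av b _ _ _ full _ ℓ-max ℓ<z z<q z<b = ⊥-elim (<⇒≱ ℓ<z (ℓ-max (full ℓ<z z<q z<b)))
    upper-full (u ∷ us) av b (f ∷ D) A us<b full ℓ∈ ℓ-max {z} ℓ<z z<q z<b with <-cmp z u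
    ... | tri≈ _ refl _ = here refl
    ... | tri> _ _ u<z = ⊥-elim (<⇒≱ ℓ<z (ℓ-max (unpairedLower-keeps (u ∷ us) av b z (f ∷ D) A us<b full ℓ∈
                           (full ℓ<z z<q z<b) ℓ<z u∷us<z (λ p → <-trans (u∷us<z p) z<q))))
      where u∷us<z : ∀ {v} → v ∈ u ∷ us → v < z
            u∷us<z (here refl) = u<z
            u∷us<z (there r) = <-trans (f r) u<z
    ... | tri< z<u _ _ with takeGE u av in e
    ...   | just av′ = there (upper-full us av′ u D (taken-Asc A (takeGE-just u av e)) f
                         (available-paired A e (us<b (here refl)) full) ℓ∈ ℓ-max ℓ<z z<q z<u)
    ...   | nothing = there (upper-full us av u D A f (available-unpaired (us<b (here refl)) full)
                         ℓ∈ ℓ-max ℓ<z z<q z<u)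

  module AfterRaising (U Y : List ℕ) (ℓ q : ℕ) (U-Asc : Asc U) (Y-Asc : Asc Y)
    (ℓ∉Y : ℓ ∈ Y → ⊥) (q∉U : q ∈ U → ⊥) (ℓ<q : ℓ < q)
    (ℓ-rightmost : lastL (unpairedLower (reverse U) (insA ℓ Y)) ≡ just ℓ)
    (Y-full : ∀ {z} → ℓ < z → z < q → z ∈ Y) where

    open ReverseSplit (reverseSplit q U U-Asc q∉U)
    open Gap ℓ q

    rest : List ℕ
    rest = unpairedLower above Y

    rest-Asc : Asc rest
    rest-Asc = unpairedLower-Asc above Y Y-Asc

    ℓ∉rest : ℓ ∈ rest → ⊥
    ℓ∉rest = ℓ∉Y ∘ unpairedLower-⊆ above Y Y-Asc

    insA-rest-Asc : Asc (insA ℓ rest)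
    insA-rest-Asc = insA-Asc ℓ rest rest-Asc ℓ∉rest

    ℓ-rightmost′ : lastL (unpairedLower below (unpairedLower above (insA ℓ Y))) ≡ just ℓ
    ℓ-rightmost′ = subst (λ r → lastL r ≡ just ℓ)
      (trans (cong (λ us → unpairedLower us (insA ℓ Y)) reverse≡) (cong proj₂ (pairStep-++ above below (insA ℓ Y))))
      ℓ-rightmost

    pairStep-above : pairStep above (insA ℓ Y) ≡ (unpairedUpper above Y , insA ℓ rest)
    pairStep-above = pairStep-insA above ℓ Y Y-Asc ℓ∉Y
      (inj₁ (unpairedLower-⊆ below _ (unpairedLower-Asc above _ (insA-Asc ℓ Y Y-Asc ℓ∉Y)) (lastL-∈ _ ℓ-rightmost′)))

    original : List ℕ
    original = unpairedLower below (insA ℓ rest)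

    ℓ-rightmost-original : lastL original ≡ just ℓ
    ℓ-rightmost-original = subst (λ av → lastL (unpairedLower below av) ≡ just ℓ) (cong proj₂ pairStep-above) ℓ-rightmost′

    ℓ∈original : ℓ ∈ original
    ℓ∈original = lastL-∈ original ℓ-rightmost-original

    original≤ℓ : ∀ {y} → y ∈ original → y ≤ ℓ
    original≤ℓ = lastL-max original (unpairedLower-Asc below _ insA-rest-Asc) ℓ-rightmost-original

    available : Available q (insA ℓ rest)
    available {z} ℓ<z z<q _ =
      insA-∈⁺ ℓ rest (unpairedLower-keepsBelow above Y z Y-Asc (<-trans z<q ∘ q<above) (Y-full ℓ<z z<q))

    -- A lower cross at or right of q would survive to the end, right of ℓ.
    q-unpaired : takeGE q rest ≡ nothing
    q-unpaired with takeGE q rest in e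
    ... | nothing = refl
    ... | just _ = ⊥-elim (<⇒≱ ℓ<x (original≤ℓ x∈original))
      where
      t = takeGE-just q rest e
      ℓ<x = <-≤-trans ℓ<q (Taken.u≤x t)
      x∈original = unpairedLower-keeps below (insA ℓ rest) q (Taken.x t) below-Desc insA-rest-Asc below<q
        available ℓ∈original (insA-∈⁺ ℓ rest (taken-x∈ rest-Asc t)) ℓ<x
        (λ p → <-≤-trans (below<q p) (Taken.u≤x t)) below<q

    below-paired : unpairedUpper below rest ≡ []
    below-paired = trans (sym (cong proj₁ (pairStep-insA below ℓ rest rest-Asc ℓ∉rest (inj₁ ℓ∈original))))
      (allUpperPaired below (insA ℓ rest) q below-Desc insA-rest-Asc below<q available ℓ∈original below<q)

    leftmostUnpairedUpper : lastL (unpairedUpper (reverse (insA q U)) Y) ≡ just q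
    leftmostUnpairedUpper = begin
        lastL (unpairedUpper (reverse (insA q U)) Y)
      ≡⟨ cong (λ us → lastL (unpairedUpper us Y)) reverse-insA≡ ⟩
        lastL (unpairedUpper (above ++ q ∷ below) Y)
      ≡⟨ cong (lastL ∘ proj₁) (pairStep-++ above (q ∷ below) Y) ⟩
        lastL (unpairedUpper above Y ++ unpairedUpper (q ∷ below) rest)
      ≡⟨ cong (λ r → lastL (unpairedUpper above Y ++ proj₁ r)) (pairStep-unpaired q below rest q-unpaired) ⟩
        lastL (unpairedUpper above Y ++ q ∷ unpairedUpper below rest)
      ≡⟨ cong (λ r → lastL (unpairedUpper above Y ++ q ∷ r)) below-paired ⟩
        lastL (unpairedUpper above Y ++ q ∷ [])
      ≡⟨ lastL-snoc (unpairedUpper above Y) q ⟩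
        just q
      ∎ where open ≡-Reasoning

  unpairedUpper∉lower : ∀ us av j → Desc us → Asc av → j ∈ unpairedUpper us av → j ∈ av → ⊥
  unpairedUpper∉lower (u ∷ us) av j (f ∷ D) A p q with takeGE u av in e
  ... | just av′ = let t = takeGE-just u av e in
    unpairedUpper∉lower us av′ j D (taken-Asc A t) p (taken-keepBelow A t q (f (unpairedUpper-⊆ us av′ p)))
  unpairedUpper∉lower (u ∷ us) av j (f ∷ D) A (here refl) q | nothing = <-irrefl refl (takeGE-nothing u av e q)
  unpairedUpper∉lower (u ∷ us) av j (f ∷ D) A (there p) q | nothing = unpairedUpper∉lower us av j D A p q

  takeGE-++ : ∀ u av bs {av′} → takeGE u av ≡ just av′ → takeGE u (av ++ bs) ≡ just (av′ ++ bs)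
  takeGE-++ u (c ∷ cs) bs e with u ≤ᵇ c
  takeGE-++ u (c ∷ cs) bs refl | true = refl
  ... | false with takeGE u cs in e′
  ...   | just cs′ rewrite takeGE-++ u cs bs e′ | just-injective (sym e) = refl

  <-of-∉ : ∀ {A : List ℕ} {c} → (c ∈ A → ⊥) → (∀ {z} → z ∈ A → c < z → ⊥) → ∀ {z} → z ∈ A → z < c
  <-of-∉ {c = c} c∉ ¬c< {z} p with <-cmp z c
  ... | tri< z<c _ _ = z<c
  ... | tri≈ _ refl _ = ⊥-elim (c∉ p)
  ... | tri> _ _ c<z = ⊥-elim (¬c< p c<z)

  pairStep-insA-allPaired : ∀ us A c → Desc us → Asc A → (c ∈ A → ⊥) → (c ∈ us → ⊥) →
    (∀ {z} → z ∈ A → c < z → z ∈ us) → unpairedUpper us A ≡ [] →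
    (pairStep us (insA c A) ≡ ([] , insA c (unpairedLower us A))) × (∀ {z} → z ∈ unpairedLower us A → z < c)
  pairStep-insA-allPaired [] A c _ _ c∉A _ A>c⊆us _ = refl , <-of-∉ c∉A (λ p c<z → ∉[] (A>c⊆us p c<z))
    where ∉[] : ∀ {z : ℕ} → z ∈ [] → ⊥
          ∉[] ()
  pairStep-insA-allPaired (u ∷ us) A c (f ∷ D) A-Asc c∉A c∉us A>c⊆us paired with takeGE u A in e
  ... | just A′ with <-cmp u c
  ...   | tri≈ _ refl _ = ⊥-elim (c∉us (here refl))
  ...   | tri> _ _ c<u = trans (pairStep-paired u us (insA c A) takes-u) (proj₁ rec) , proj₂ rec
    where
    t = takeGE-just u A e
    x≡u : Taken.x t ≡ u
    x≡u with A>c⊆us (taken-x∈ A-Asc t) (<-≤-trans c<u (Taken.u≤x t))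
    ... | here eq = eq
    ... | there q = ⊥-elim (<⇒≱ (f q) (Taken.u≤x t))
    takes-u : takeGE u (insA c A) ≡ just (insA c A′)
    takes-u with takeGE-insA u c A A-Asc c∉A
    ... | commutes eq rewrite e = eq
    ... | takes-ℓ _ u≤c _ = ⊥-elim (<⇒≱ c<u u≤c)
    A′>c⊆us : ∀ {z} → z ∈ A′ → c < z → z ∈ us
    A′>c⊆us p c<z with A>c⊆us (taken-⊆ A-Asc t p) c<z
    ... | there q = q
    ... | here refl = ⊥-elim (taken-x∉ A-Asc t (subst (_∈ A′) (sym x≡u) p))
    rec = pairStep-insA-allPaired us A′ c D (taken-Asc A-Asc t) (c∉A ∘ taken-⊆ A-Asc t) (c∉us ∘ there) A′>c⊆us paired
  ...   | tri< u<c _ _ = trans (pairStep-paired u us (insA c A) takes-u) (proj₁ rec) , proj₂ rec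
    where
    t = takeGE-just u A e
    A<c : ∀ {z} → z ∈ A → z < c
    A<c = <-of-∉ c∉A (λ p c<z → <-asym c<z (<-Desc-head u<c (A>c⊆us p c<z)))
      where <-Desc-head : ∀ {z} → u < c → z ∈ u ∷ us → z < c
            <-Desc-head u<c (here refl) = u<c
            <-Desc-head u<c (there q) = <-trans (f q) u<c
    takes-u : takeGE u (insA c A) ≡ just (insA c A′)
    takes-u rewrite insA-max c A A<c | insA-max c A′ (A<c ∘ taken-⊆ A-Asc t) = takeGE-++ u A (c ∷ []) e
    rec = pairStep-insA-allPaired us A′ c D (taken-Asc A-Asc t) (c∉A ∘ taken-⊆ A-Asc t) (c∉us ∘ there)
            (λ p c<z → ⊥-elim (<-asym c<z (A<c (taken-⊆ A-Asc t p)))) paired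

  module AfterLowering (X Y : List ℕ) (j c : ℕ) (X-Asc : Asc X) (Y-Asc : Asc Y)
    (j∉X : j ∈ X → ⊥) (c∉X : c ∈ X → ⊥) (c∉Y : c ∈ Y → ⊥) (c<j : c < j)
    (j-leftmost : lastL (unpairedUpper (reverse (insA j X)) Y) ≡ just j)
    (X-full : ∀ {z} → c < z → z < j → z ∈ X) where

    open ReverseSplit (reverseSplit j X X-Asc j∉X)

    rest : List ℕ
    rest = unpairedLower above Y

    original : List ℕ
    original = unpairedUpper (above ++ j ∷ below) Y

    original≡ : original ≡ unpairedUpper above Y ++ unpairedUpper (j ∷ below) rest
    original≡ = cong proj₁ (pairStep-++ above (j ∷ below) Y)

    j-leftmost-original : lastL original ≡ just j
    j-leftmost-original = subst (λ us → lastL (unpairedUpper us Y) ≡ just j) reverse-insA≡ j-leftmost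

    j∈original : j ∈ original
    j∈original = lastL-∈ original j-leftmost-original

    j≤original : ∀ {y} → y ∈ original → j ≤ y
    j≤original = lastL-min original
      (unpairedUpper-Desc _ Y (subst Desc reverse-insA≡ (reverse-Asc (insA j X) (insA-Asc j X X-Asc j∉X))))
      j-leftmost-original

    j-unpaired : takeGE j rest ≡ nothing
    j-unpaired with takeGE j rest in e
    ... | nothing = refl
    ... | just rest′ with ∈-++⁻ (unpairedUpper above Y)
           (subst (j ∈_) (trans original≡ (cong (λ r → unpairedUpper above Y ++ proj₁ r) (pairStep-paired j below rest e)))
             j∈original)
    ...   | inj₁ p = ⊥-elim (<-irrefl refl (q<above (unpairedUpper-⊆ above Y p)))
    ...   | inj₂ p = ⊥-elim (<-irrefl refl (below<q (unpairedUpper-⊆ below rest′ p)))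

    rest<j : ∀ {z} → z ∈ rest → z < j
    rest<j = takeGE-nothing j rest j-unpaired

    below-paired : unpairedUpper below rest ≡ []
    below-paired = ≡[]-of-∉ _ (λ p → <⇒≱ (below<q (unpairedUpper-⊆ below rest p)) (j≤original (subst (_ ∈_)
      (sym (trans original≡ (cong (λ r → unpairedUpper above Y ++ proj₁ r) (pairStep-unpaired j below rest j-unpaired))))
      (∈-++⁺ʳ (unpairedUpper above Y) (there p)))))

    rest>c⊆below : ∀ {z} → z ∈ rest → c < z → z ∈ below
    rest>c⊆below {z} p c<z with ∈-++⁻ above (subst (z ∈_) reverse≡ (reverse⁺ (X-full c<z (rest<j p))))
    ... | inj₁ q = ⊥-elim (<-asym (rest<j p) (q<above q))
    ... | inj₂ q = q

    c-unpaired : (pairStep below (insA c rest) ≡ ([] , insA c (unpairedLower below rest))) ×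
                 (∀ {z} → z ∈ unpairedLower below rest → z < c)
    c-unpaired = pairStep-insA-allPaired below rest c below-Desc (unpairedLower-Asc above Y Y-Asc)
              (c∉Y ∘ unpairedLower-⊆ above Y Y-Asc) (c∉X ∘ below-⊆) rest>c⊆below below-paired

    rightmostUnpairedLower : lastL (unpairedLower (reverse X) (insA c Y)) ≡ just c
    rightmostUnpairedLower = begin
        lastL (unpairedLower (reverse X) (insA c Y))
      ≡⟨ cong (λ us → lastL (unpairedLower us (insA c Y))) reverse≡ ⟩
        lastL (unpairedLower (above ++ below) (insA c Y))
      ≡⟨ cong (lastL ∘ proj₂) (pairStep-++ above below (insA c Y)) ⟩
        lastL (unpairedLower below (unpairedLower above (insA c Y)))
      ≡⟨ cong (λ r → lastL (unpairedLower below (proj₂ r)))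
           (pairStep-insA above c Y Y-Asc c∉Y (inj₂ (<-trans c<j ∘ q<above))) ⟩
        lastL (unpairedLower below (insA c rest))
      ≡⟨ cong (lastL ∘ proj₂) (proj₁ c-unpaired) ⟩
        lastL (insA c (unpairedLower below rest))
      ≡⟨ cong lastL (insA-max c _ (proj₂ c-unpaired)) ⟩
        lastL (unpairedLower below rest ++ c ∷ [])
      ≡⟨ lastL-snoc (unpairedLower below rest) c ⟩
        just c
      ∎ where open ≡-Reasoning

  cols≡ : ∀ n → cols n ≡ applyUpTo suc n
  cols≡ n = map-suc-applyUpTo (λ x → x) n
    where map-suc-applyUpTo : ∀ (f : ℕ → ℕ) n → map suc (applyUpTo f n) ≡ applyUpTo (suc ∘ f) n
          map-suc-applyUpTo f zero = refl
          map-suc-applyUpTo f (suc n) = cong (suc (f 0) ∷_) (map-suc-applyUpTo (f ∘ suc) n)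

  applyUpTo-Asc : ∀ (f : ℕ → ℕ) n → (∀ {a b} → a < b → f a < f b) → Asc (applyUpTo f n)
  applyUpTo-Asc f zero mono = []
  applyUpTo-Asc f (suc n) mono = f0< ∷ applyUpTo-Asc (f ∘ suc) n (mono ∘ s≤s)
    where f0< : ∀ {y} → y ∈ applyUpTo (f ∘ suc) n → f 0 < y
          f0< p with ∈-applyUpTo⁻ (f ∘ suc) p
          ... | _ , _ , refl = mono (s≤s z≤n)

  cols-Asc : ∀ n → Asc (cols n)
  cols-Asc n rewrite cols≡ n = applyUpTo-Asc suc n s≤s

  ∈-cols⁺ : ∀ {n y} → 1 ≤ y → y ≤ n → y ∈ cols n
  ∈-cols⁺ {n} {suc y} _ y≤n rewrite cols≡ n = ∈-applyUpTo⁺ suc y≤n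

  ∈-cols⁻ : ∀ {n y} → y ∈ cols n → (1 ≤ y) × (y ≤ n)
  ∈-cols⁻ {n} p rewrite cols≡ n with ∈-applyUpTo⁻ suc p
  ... | _ , i<n , refl = s≤s z≤n , i<n

  ∈-filterᵇ⁺ : ∀ p {xs y} → y ∈ xs → p y ≡ true → y ∈ filterᵇ p xs
  ∈-filterᵇ⁺ p {x ∷ xs} (here refl) e rewrite e = here refl
  ∈-filterᵇ⁺ p {x ∷ xs} (there q) e with p x
  ... | true = there (∈-filterᵇ⁺ p q e)
  ... | false = ∈-filterᵇ⁺ p q e

  ∈-filterᵇ⁻ : ∀ p {xs y} → y ∈ filterᵇ p xs → (y ∈ xs) × (p y ≡ true)
  ∈-filterᵇ⁻ p {x ∷ xs} q with p x in e
  ∈-filterᵇ⁻ p {x ∷ xs} (here refl) | true = here refl , e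
  ∈-filterᵇ⁻ p {x ∷ xs} (there q) | true = let (a , b) = ∈-filterᵇ⁻ p q in there a , b
  ∈-filterᵇ⁻ p {x ∷ xs} q | false = let (a , b) = ∈-filterᵇ⁻ p q in there a , b

  filterᵇ-Asc : ∀ p xs → Asc xs → Asc (filterᵇ p xs)
  filterᵇ-Asc p [] [] = []
  filterᵇ-Asc p (x ∷ xs) (f ∷ A) with p x
  ... | true = (f ∘ proj₁ ∘ ∈-filterᵇ⁻ p) ∷ filterᵇ-Asc p xs A
  ... | false = filterᵇ-Asc p xs A

  filterᵇ-congᴸ : ∀ p p′ xs → (∀ {y} → y ∈ xs → p y ≡ p′ y) → filterᵇ p xs ≡ filterᵇ p′ xs
  filterᵇ-congᴸ p p′ [] e = refl
  filterᵇ-congᴸ p p′ (x ∷ xs) e rewrite e (here refl) with p′ x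
  ... | true = cong (x ∷_) (filterᵇ-congᴸ p p′ xs (e ∘ there))
  ... | false = filterᵇ-congᴸ p p′ xs (e ∘ there)

  filterᵇ-insA : ∀ p p′ q xs → Asc xs → q ∈ xs → p q ≡ false → p′ q ≡ true →
    (∀ y → y ≢ q → p′ y ≡ p y) → filterᵇ p′ xs ≡ insA q (filterᵇ p xs)
  filterᵇ-insA p p′ q (x ∷ xs) (f ∷ A) (here refl) pq p′q e rewrite pq | p′q =
    sym (trans (cong (insA q) (filterᵇ-congᴸ p p′ xs (λ r → sym (e _ (λ { refl → <-irrefl refl (f r) })))))
               (insA-min q (filterᵇ p′ xs) (f ∘ proj₁ ∘ ∈-filterᵇ⁻ p′)))
  filterᵇ-insA p p′ q (x ∷ xs) (f ∷ A) (there r) pq p′q e rewrite e x (λ { refl → <-irrefl refl (f r) }) with p x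
  ... | true rewrite insA-≥ {q} {x} (filterᵇ p xs) (<ᵇ-false (<⇒≤ (f r))) =
    cong (x ∷_) (filterᵇ-insA p p′ q xs A r pq p′q e)
  ... | false = filterᵇ-insA p p′ q xs A r pq p′q e

  rowCrosses-Asc : ∀ n G r → Asc (rowCrosses n G r)
  rowCrosses-Asc n G r = filterᵇ-Asc (G r) (cols n) (cols-Asc n)

  ∈-rowCrosses⁺ : ∀ {n} G r {y} → G r y ≡ true → 1 ≤ y → y ≤ n → y ∈ rowCrosses n G r
  ∈-rowCrosses⁺ G r g 1≤y y≤n = ∈-filterᵇ⁺ (G r) (∈-cols⁺ 1≤y y≤n) g

  ∈-rowCrosses⁻ : ∀ n G r {y} → y ∈ rowCrosses n G r → (G r y ≡ true) × (1 ≤ y) × (y ≤ n)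
  ∈-rowCrosses⁻ n G r p with ∈-filterᵇ⁻ (G r) p
  ... | y∈cols , g = g , ∈-cols⁻ y∈cols

  ∉-rowCrosses : ∀ {n} G r {y} → G r y ≡ false → y ∈ rowCrosses n G r → ⊥
  ∉-rowCrosses {n} G r g p with trans (sym (proj₁ (∈-rowCrosses⁻ n G r p))) g
  ... | ()

  rowCrosses-cong : ∀ n G G′ r → (∀ y → G r y ≡ G′ r y) → rowCrosses n G r ≡ rowCrosses n G′ r
  rowCrosses-cong n G G′ r h = filterᵇ-congᴸ (G r) (G′ r) (cols n) (λ {y} _ → h y)

  rowCrosses-insA : ∀ n G G′ r q → G′ r q ≡ true → G r q ≡ false → (∀ y → y ≢ q → G′ r y ≡ G r y) →
    1 ≤ q → q ≤ n → rowCrosses n G′ r ≡ insA q (rowCrosses n G r)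
  rowCrosses-insA n G G′ r q g′ g h 1≤q q≤n =
    filterᵇ-insA (G r) (G′ r) q (cols n) (cols-Asc n) (∈-cols⁺ 1≤q q≤n) g g′ h

  Box : Set
  Box = ℕ × ℕ

  Trace : Set
  Trace = List Box × Maybe ℕ

  infixr 5 _◂_
  _◂_ : List Box → Trace → Trace
  L ◂ T = (L ++ proj₁ T , proj₂ T)

  ◂-assoc : ∀ L₁ L₂ T → L₁ ◂ (L₂ ◂ T) ≡ (L₁ ++ L₂) ◂ T
  ◂-assoc L₁ L₂ T = cong (_, proj₂ T) (sym (++-assoc L₁ L₂ (proj₁ T)))

  rowSeg : ℕ → ℕ → ℕ → List Box
  rowSeg r c zero = []
  rowSeg r c (suc m) = (r , c) ∷ rowSeg r (suc c) m

  ∈-rowSeg⁺ : ∀ {r c m y} → c ≤ y → y < c + m → (r , y) ∈ rowSeg r c m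
  ∈-rowSeg⁺ {r} {c} {zero} c≤y y<c rewrite +-identityʳ c = ⊥-elim (<⇒≱ y<c c≤y)
  ∈-rowSeg⁺ {r} {c} {suc m} {y} c≤y y< with c ≟ y
  ... | yes refl = here refl
  ... | no c≢y = there (∈-rowSeg⁺ (≤∧≢⇒< c≤y c≢y) (subst (y <_) (+-suc c m) y<))

  ∈-rowSeg⁻ : ∀ {r c m b} → b ∈ rowSeg r c m → (proj₁ b ≡ r) × (c ≤ proj₂ b) × (proj₂ b < c + m)
  ∈-rowSeg⁻ {r} {c} {suc m} (here refl) = refl , ≤-refl , subst (c <_) (sym (+-suc c m)) (s≤s (m≤m+n c m))
  ∈-rowSeg⁻ {r} {c} {suc m} {b} (there p) with ∈-rowSeg⁻ {r} {suc c} {m} p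
  ... | r≡ , c<y , y< = r≡ , <⇒≤ c<y , subst (proj₂ b <_) (sym (+-suc c m)) y<

  module Rectangle (i₀ ℓ k : ℕ) where

    i q : ℕ
    i = suc i₀
    q = suc ℓ + k

    LL UL UR LR : Box
    LL = (suc i , ℓ)
    UL = (i , ℓ)
    UR = (i , q)
    LR = (suc i , q)

    lowerMid upperMid lowerRoute upperRoute : List Box
    lowerMid = rowSeg (suc i) (suc ℓ) k
    upperMid = rowSeg i (suc ℓ) k
    lowerRoute = LL ∷ lowerMid ++ LR ∷ UR ∷ []
    upperRoute = LL ∷ UL ∷ upperMid ++ UR ∷ []

  -- The hypothesis is the fuel invariant r + n ≤ f + c of a pipe trace, at the corner LL.
  rectangle-fuel : ∀ {n i₀ ℓ k} f → suc ℓ + k ≤ n → suc (suc i₀) + n ≤ f + ℓ → 3 + k ≤ f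
  rectangle-fuel {n} {i₀} {ℓ} {k} f q≤n h = +-cancelʳ-≤ ℓ (3 + k) f (begin
      3 + k + ℓ            ≡⟨ cong (suc ∘ suc) (trans (+-comm (suc k) ℓ) (+-suc ℓ k)) ⟩
      2 + (suc ℓ + k)      ≤⟨ s≤s (s≤s q≤n) ⟩
      2 + n                ≤⟨ s≤s (s≤s (m≤n+m n i₀)) ⟩
      suc (suc i₀) + n     ≤⟨ h ⟩
      f + ℓ                ∎)
    where open ≤-Reasoning

  module Tracing (n : ℕ) (K : Grid) where

    tr : ℕ → ℕ → ℕ → Dir → Trace
    tr = trace n K

    next : ℕ → ℕ → ℕ → Bool → Dir → Trace
    next f r c true  fromLeft   = tr f (suc r) (suc c) fromLeft
    next f r c false fromLeft   = tr f r c fromBottom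
    next f r c true  fromBottom = tr f r c fromBottom
    next f r c false fromBottom = tr f (suc r) (suc c) fromLeft

    tr-step : ∀ f r c d → c ≤ n → tr (suc f) (suc r) c d ≡ ((suc r , c) ∷ []) ◂ next f r c (K (suc r) c) d
    tr-step f r c d c≤n with n <ᵇ c in e
    ... | true = ⊥-elim (<⇒≱ (<ᵇ-true⇒ e) c≤n)
    ... | false with K (suc r) c | d
    ...   | true  | fromLeft   = refl
    ...   | false | fromLeft   = refl
    ...   | true  | fromBottom = refl
    ...   | false | fromBottom = refl

    tr-outside : ∀ f r c d → n < c → tr (suc f) (suc r) c d ≡ ([] , nothing)
    tr-outside f r c d n<c rewrite <ᵇ-true n<c = refl

    cross-fromLeft : ∀ f r c → K (suc r) c ≡ true → c ≤ n →
      tr (suc f) (suc r) c fromLeft ≡ ((suc r , c) ∷ []) ◂ tr f (suc r) (suc c) fromLeft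
    cross-fromLeft f r c e c≤n rewrite tr-step f r c fromLeft c≤n | e = refl

    elbow-fromLeft : ∀ f r c → K (suc r) c ≡ false → c ≤ n →
      tr (suc f) (suc r) c fromLeft ≡ ((suc r , c) ∷ []) ◂ tr f r c fromBottom
    elbow-fromLeft f r c e c≤n rewrite tr-step f r c fromLeft c≤n | e = refl

    cross-fromBottom : ∀ f r c → K (suc r) c ≡ true → c ≤ n →
      tr (suc f) (suc r) c fromBottom ≡ ((suc r , c) ∷ []) ◂ tr f r c fromBottom
    cross-fromBottom f r c e c≤n rewrite tr-step f r c fromBottom c≤n | e = refl

    elbow-fromBottom : ∀ f r c → K (suc r) c ≡ false → c ≤ n →
      tr (suc f) (suc r) c fromBottom ≡ ((suc r , c) ∷ []) ◂ tr f (suc r) (suc c) fromLeft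
    elbow-fromBottom f r c e c≤n rewrite tr-step f r c fromBottom c≤n | e = refl

    across : ∀ m f r c → (∀ y → c ≤ y → y < c + m → K (suc r) y ≡ true) → c + m ≤ suc n →
      tr (m + f) (suc r) c fromLeft ≡ rowSeg (suc r) c m ◂ tr f (suc r) (c + m) fromLeft
    across zero f r c _ _ rewrite +-identityʳ c = refl
    across (suc m) f r c full c+m≤
      rewrite cross-fromLeft (m + f) r c (full c ≤-refl (subst (c <_) (sym (+-suc c m)) (s≤s (m≤m+n c m))))
                (≤-trans (m≤m+n c m) (≤-pred (subst (_≤ suc n) (+-suc c m) c+m≤)))
            | across m f r (suc c) (λ y c<y y< → full y (<⇒≤ c<y) (subst (y <_) (sym (+-suc c m)) y<))
                (subst (_≤ suc n) (+-suc c m) c+m≤)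
            | +-suc c m = refl

    module Routes (i₀ ℓ k : ℕ) (q≤n : suc ℓ + k ≤ n) where
      open Rectangle i₀ ℓ k

      private
        ℓ≤n : ℓ ≤ n
        ℓ≤n = ≤-trans (n≤1+n ℓ) (≤-trans (m≤m+n (suc ℓ) k) q≤n)

        q≤1+n : q ≤ suc n
        q≤1+n = ≤-trans q≤n (n≤1+n n)

        fuel-lower : ∀ f → 3 + k + f ≡ suc (k + suc (suc f))
        fuel-lower f = cong suc (sym (trans (+-suc k (suc f)) (cong suc (+-suc k f))))

        fuel-upper : ∀ f → 3 + k + f ≡ suc (suc (k + suc f))
        fuel-upper f = cong (suc ∘ suc) (sym (+-suc k f))

      module _ (mid : ∀ y → ℓ < y → y < q → K (suc i) y ≡ true) (K↓q : K (suc i) q ≡ false) where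

        lowerRoute-tail : ∀ f →
          tr (k + suc (suc f)) (suc i) (suc ℓ) fromLeft ≡ (lowerMid ++ LR ∷ UR ∷ []) ◂ next f i₀ q (K i q) fromBottom
        lowerRoute-tail f = begin
            tr (k + suc (suc f)) (suc i) (suc ℓ) fromLeft
          ≡⟨ across k _ i (suc ℓ) mid q≤1+n ⟩
            lowerMid ◂ tr (suc (suc f)) (suc i) q fromLeft
          ≡⟨ cong (lowerMid ◂_) (elbow-fromLeft _ i q K↓q q≤n) ⟩
            lowerMid ◂ (LR ∷ []) ◂ tr (suc f) i q fromBottom
          ≡⟨ cong (λ T → lowerMid ◂ (LR ∷ []) ◂ T) (tr-step f i₀ q fromBottom q≤n) ⟩
            lowerMid ◂ (LR ∷ UR ∷ []) ◂ next f i₀ q (K i q) fromBottom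
          ≡⟨ ◂-assoc lowerMid (LR ∷ UR ∷ []) _ ⟩
            (lowerMid ++ LR ∷ UR ∷ []) ◂ next f i₀ q (K i q) fromBottom
          ∎ where open ≡-Reasoning

        lowerRoute-fromLeft : K (suc i) ℓ ≡ true → ∀ f →
          tr (3 + k + f) (suc i) ℓ fromLeft ≡ lowerRoute ◂ next f i₀ q (K i q) fromBottom
        lowerRoute-fromLeft K↓ℓ f = trans (cong (λ F → tr F (suc i) ℓ fromLeft) (fuel-lower f))
          (trans (cross-fromLeft _ i ℓ K↓ℓ ℓ≤n) (cong ((LL ∷ []) ◂_) (lowerRoute-tail f)))

        lowerRoute-fromBottom : K (suc i) ℓ ≡ false → ∀ f →
          tr (3 + k + f) (suc i) ℓ fromBottom ≡ lowerRoute ◂ next f i₀ q (K i q) fromBottom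
        lowerRoute-fromBottom K↓ℓ f = trans (cong (λ F → tr F (suc i) ℓ fromBottom) (fuel-lower f))
          (trans (elbow-fromBottom _ i ℓ K↓ℓ ℓ≤n) (cong ((LL ∷ []) ◂_) (lowerRoute-tail f)))

      module _ (K↑ℓ : K i ℓ ≡ false) (mid : ∀ y → ℓ < y → y < q → K i y ≡ true) where

        upperRoute-tail : ∀ f →
          tr (suc (k + suc f)) i ℓ fromBottom ≡ (UL ∷ upperMid ++ UR ∷ []) ◂ next f i₀ q (K i q) fromLeft
        upperRoute-tail f = begin
            tr (suc (k + suc f)) i ℓ fromBottom
          ≡⟨ elbow-fromBottom _ i₀ ℓ K↑ℓ ℓ≤n ⟩
            (UL ∷ []) ◂ tr (k + suc f) i (suc ℓ) fromLeft
          ≡⟨ cong ((UL ∷ []) ◂_) (across k _ i₀ (suc ℓ) mid q≤1+n) ⟩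
            (UL ∷ []) ◂ upperMid ◂ tr (suc f) i q fromLeft
          ≡⟨ cong (λ T → (UL ∷ []) ◂ upperMid ◂ T) (tr-step f i₀ q fromLeft q≤n) ⟩
            (UL ∷ upperMid) ◂ (UR ∷ []) ◂ next f i₀ q (K i q) fromLeft
          ≡⟨ ◂-assoc (UL ∷ upperMid) (UR ∷ []) _ ⟩
            (UL ∷ upperMid ++ UR ∷ []) ◂ next f i₀ q (K i q) fromLeft
          ∎ where open ≡-Reasoning

        upperRoute-fromBottom : K (suc i) ℓ ≡ true → ∀ f →
          tr (3 + k + f) (suc i) ℓ fromBottom ≡ upperRoute ◂ next f i₀ q (K i q) fromLeft
        upperRoute-fromBottom K↓ℓ f = trans (cong (λ F → tr F (suc i) ℓ fromBottom) (fuel-upper f))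
          (trans (cross-fromBottom _ i ℓ K↓ℓ ℓ≤n) (cong ((LL ∷ []) ◂_) (upperRoute-tail f)))

        upperRoute-fromLeft : K (suc i) ℓ ≡ false → ∀ f →
          tr (3 + k + f) (suc i) ℓ fromLeft ≡ upperRoute ◂ next f i₀ q (K i q) fromLeft
        upperRoute-fromLeft K↓ℓ f = trans (cong (λ F → tr F (suc i) ℓ fromLeft) (fuel-upper f))
          (trans (elbow-fromLeft _ i ℓ K↓ℓ ℓ≤n) (cong ((LL ∷ []) ◂_) (upperRoute-tail f)))

  memBox-∈ : ∀ {b L} → b ∈ L → memBox b L ≡ true
  memBox-∈ {a , b} {(x , y) ∷ L} (here refl) rewrite ≡ᵇ-refl a | ≡ᵇ-refl b = refl
  memBox-∈ {a , b} {(x , y) ∷ L} (there p) with (a ≡ᵇ x) ∧ (b ≡ᵇ y)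
  ... | true = refl
  ... | false = memBox-∈ p

  memBox-true⇒∈ : ∀ {b L} → memBox b L ≡ true → b ∈ L
  memBox-true⇒∈ {a , b} {(x , y) ∷ L} e with a ≡ᵇ x in e₁ | b ≡ᵇ y in e₂
  ... | true  | true  = here (cong₂ _,_ (≡ᵇ-true⇒ e₁) (≡ᵇ-true⇒ e₂))
  ... | true  | false = there (memBox-true⇒∈ e)
  ... | false | _     = there (memBox-true⇒∈ e)

  memBox-∉ : ∀ {b L} → (b ∈ L → ⊥) → memBox b L ≡ false
  memBox-∉ {b} {L} b∉ with memBox b L in e
  ... | false = refl
  ... | true = ⊥-elim (b∉ (memBox-true⇒∈ e))

  memBox-++ : ∀ b L₁ L₂ → memBox b (L₁ ++ L₂) ≡ memBox b L₁ ∨ memBox b L₂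
  memBox-++ b [] L₂ = refl
  memBox-++ (a , b) ((x , y) ∷ L₁) L₂ with (a ≡ᵇ x) ∧ (b ≡ᵇ y)
  ... | true = refl
  ... | false = memBox-++ (a , b) L₁ L₂

  crossCount : Grid → List Box → List Box → ℕ
  crossCount K Q [] = 0
  crossCount K Q ((x , y) ∷ xs) = if K x y ∧ memBox (x , y) Q then suc (crossCount K Q xs) else crossCount K Q xs

  -- crossings is defined through a local function of Defs; the metavariable
  -- crossings-go is solved by unification with it.
  mutual
    crossings-go : ℕ → Grid → ℕ → ℕ → List Box → ℕ
    crossings-go = _

    crossings-unfold : ∀ n D a b → crossings n D a b ≡ crossings-go n D a b (proj₁ (pipe n D a))
    crossings-unfold n D a b with proj₁ (pipe n D a)
    ... | xs = refl

  crossings-go≡crossCount : ∀ n D a b xs → crossings-go n D a b xs ≡ crossCount D (proj₁ (pipe n D b)) xs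
  crossings-go≡crossCount n D a b [] = refl
  crossings-go≡crossCount n D a b ((x , y) ∷ xs) with D x y ∧ memBox (x , y) (proj₁ (pipe n D b))
  ... | true = cong suc (crossings-go≡crossCount n D a b xs)
  ... | false = crossings-go≡crossCount n D a b xs

  crossings≡crossCount : ∀ n D a b → crossings n D a b ≡ crossCount D (proj₁ (pipe n D b)) (proj₁ (pipe n D a))
  crossings≡crossCount n D a b =
    trans (crossings-unfold n D a b) (crossings-go≡crossCount n D a b (proj₁ (pipe n D a)))

  indicator : Bool → ℕ
  indicator true = 1
  indicator false = 0

  crossCount-∷ : ∀ K Q b L → crossCount K Q (b ∷ L) ≡ indicator (K (proj₁ b) (proj₂ b) ∧ memBox b Q) + crossCount K Q L
  crossCount-∷ K Q (x , y) L with K x y ∧ memBox (x , y) Q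
  ... | true = refl
  ... | false = refl

  crossCount-cross : ∀ K Q x y L → K x y ≡ true → crossCount K Q ((x , y) ∷ L) ≡ indicator (memBox (x , y) Q) + crossCount K Q L
  crossCount-cross K Q x y L e rewrite e with memBox (x , y) Q
  ... | true = refl
  ... | false = refl

  crossCount-elbow : ∀ K Q x y L → K x y ≡ false → crossCount K Q ((x , y) ∷ L) ≡ crossCount K Q L
  crossCount-elbow K Q x y L e rewrite e = refl

  crossCount-++ : ∀ K Q xs ys → crossCount K Q (xs ++ ys) ≡ crossCount K Q xs + crossCount K Q ys
  crossCount-++ K Q [] ys = refl
  crossCount-++ K Q ((x , y) ∷ xs) ys with K x y ∧ memBox (x , y) Q
  ... | true = cong suc (crossCount-++ K Q xs ys)
  ... | false = crossCount-++ K Q xs ys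

  crossCount-[] : ∀ K L → crossCount K [] L ≡ 0
  crossCount-[] K [] = refl
  crossCount-[] K ((x , y) ∷ L) rewrite ∧-zeroʳ (K x y) = crossCount-[] K L

  crossCount-elbowPath : ∀ K b L → K (proj₁ b) (proj₂ b) ≡ false → crossCount K (b ∷ []) L ≡ 0
  crossCount-elbowPath K b [] e = refl
  crossCount-elbowPath K b (x ∷ L) e rewrite crossCount-∷ K (b ∷ []) x L | crossCount-elbowPath K b L e
    with memBox x (b ∷ []) in m
  ... | false rewrite ∧-zeroʳ (K (proj₁ x) (proj₂ x)) = refl
  ... | true with memBox-true⇒∈ {x} {b ∷ []} m
  ...   | here refl rewrite e = refl

  crossCount-cong : ∀ K K′ Q Q′ L → (∀ {b} → b ∈ L → K (proj₁ b) (proj₂ b) ≡ K′ (proj₁ b) (proj₂ b)) →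
    (∀ {b} → b ∈ L → memBox b Q ≡ memBox b Q′) → crossCount K Q L ≡ crossCount K′ Q′ L
  crossCount-cong K K′ Q Q′ [] _ _ = refl
  crossCount-cong K K′ Q Q′ (b ∷ L) hK hQ
    rewrite crossCount-∷ K Q b L | crossCount-∷ K′ Q′ b L | hK (here refl) | hQ (here refl)
          | crossCount-cong K K′ Q Q′ L (hK ∘ there) (hQ ∘ there) = refl

  memberCount : List Box → List Box → ℕ
  memberCount Q [] = 0
  memberCount Q (b ∷ L) = indicator (memBox b Q) + memberCount Q L

  crossCount-allCrosses : ∀ K Q L → (∀ {b} → b ∈ L → K (proj₁ b) (proj₂ b) ≡ true) → crossCount K Q L ≡ memberCount Q L
  crossCount-allCrosses K Q [] h = refl
  crossCount-allCrosses K Q (b ∷ L) h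
    rewrite crossCount-∷ K Q b L | h (here refl) | crossCount-allCrosses K Q L (h ∘ there) = refl

  module _ (Q : List Box) (r : ℕ) where

    private
      step : ∀ {a m y} → suc a ≤ y → y < suc a + m → a ≤ y × y < a + suc m
      step {a} {m} {y} a<y y< = <⇒≤ a<y , subst (y <_) (sym (+-suc a m)) y<

      a<a+sm : ∀ a m → a < a + suc m
      a<a+sm a m = subst (a <_) (sym (+-suc a m)) (s≤s (m≤m+n a m))

    memberCount-all : ∀ a m → (∀ y → a ≤ y → y < a + m → memBox (r , y) Q ≡ true) → memberCount Q (rowSeg r a m) ≡ m
    memberCount-all a zero h = refl
    memberCount-all a (suc m) h rewrite h a ≤-refl (a<a+sm a m) =
      cong suc (memberCount-all (suc a) m (λ y a<y y< → let (p , q) = step a<y y< in h y p q))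

    memberCount-none : ∀ a m → (∀ y → a ≤ y → y < a + m → memBox (r , y) Q ≡ false) → memberCount Q (rowSeg r a m) ≡ 0
    memberCount-none a zero h = refl
    memberCount-none a (suc m) h rewrite h a ≤-refl (a<a+sm a m) =
      memberCount-none (suc a) m (λ y a<y y< → let (p , q) = step a<y y< in h y p q)

    memberCount-one : ∀ a m c → a ≤ c → c < a + m → (∀ y → a ≤ y → y < a + m → memBox (r , y) Q ≡ (y ≡ᵇ c)) →
      memberCount Q (rowSeg r a m) ≡ 1
    memberCount-one a zero c a≤c c< h rewrite +-identityʳ a = ⊥-elim (<⇒≱ c< a≤c)
    memberCount-one a (suc m) c a≤c c< h rewrite h a ≤-refl (a<a+sm a m) with a ≟ c
    ... | yes refl rewrite ≡ᵇ-refl a = cong suc (memberCount-none (suc a) m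
            (λ y a<y y< → let (p , q) = step a<y y< in trans (h y p q) (≡ᵇ-false {y} {a} (λ { refl → <-irrefl refl a<y }))))
    ... | no a≢c rewrite ≡ᵇ-false a≢c = memberCount-one (suc a) m c (≤∧≢⇒< a≤c a≢c) (subst (c <_) (+-suc a m) c<)
            (λ y a<y y< → let (p , q) = step a<y y< in h y p q)

  -- Chute moves preserve exits and crossing numbers

  InRect : ℕ → ℕ → ℕ → ℕ → ℕ → Set
  InRect i ℓ q x y = (x ≡ i ⊎ x ≡ suc i) × (ℓ ≤ y × y ≤ q)

  inRect? : ∀ i ℓ q x y → Dec (InRect i ℓ q x y)
  inRect? i ℓ q x y = (x ≟ i ⊎-dec x ≟ suc i) ×-dec (ℓ ≤? y ×-dec y ≤? q)

  -- G and H agree outside the rectangle of rows i, i + 1 and columns ℓ … q,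
  -- where q = ℓ + 1 + k, and inside it they read (+ a cross, · an elbow)
  --
  --          ℓ         q              ℓ         q
  --    i     · + ⋯ + ·          i     · + ⋯ + +
  --    i+1   + + ⋯ + ·          i+1   · + ⋯ + ·
  record ChuteMove (n i ℓ k : ℕ) (G H : Grid) : Set where
    field
      1≤ℓ   : 1 ≤ ℓ
      q≤n   : suc ℓ + k ≤ n
      agree : ∀ x y → ¬ InRect i ℓ (suc ℓ + k) x y → G x y ≡ H x y
      G↑ℓ   : G i ℓ ≡ false
      G↑mid : ∀ y → ℓ < y → y < suc ℓ + k → G i y ≡ true
      G↑q   : G i (suc ℓ + k) ≡ false
      G↓ℓ   : G (suc i) ℓ ≡ true
      G↓mid : ∀ y → ℓ < y → y < suc ℓ + k → G (suc i) y ≡ true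
      G↓q   : G (suc i) (suc ℓ + k) ≡ false
      H↑ℓ   : H i ℓ ≡ false
      H↑mid : ∀ y → ℓ < y → y < suc ℓ + k → H i y ≡ true
      H↑q   : H i (suc ℓ + k) ≡ true
      H↓ℓ   : H (suc i) ℓ ≡ false
      H↓mid : ∀ y → ℓ < y → y < suc ℓ + k → H (suc i) y ≡ true
      H↓q   : H (suc i) (suc ℓ + k) ≡ false

  module ChuteInvariance {n i₀ ℓ k : ℕ} {G H : Grid} (chute : ChuteMove n (suc i₀) ℓ k G H) where

    open ChuteMove chute
    open Rectangle i₀ ℓ k
    module TG = Tracing n G
    module TH = Tracing n H
    module RG = TG.Routes i₀ ℓ k q≤n
    module RH = TH.Routes i₀ ℓ k q≤n

    Inside : Box → Set
    Inside (x , y) = InRect i ℓ q x y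

    Outside : Box → Set
    Outside b = ¬ Inside b

    ℓ<q : ℓ < q
    ℓ<q = s≤s (m≤m+n ℓ k)

    ℓ≤n : ℓ ≤ n
    ℓ≤n = <⇒≤ (<-≤-trans ℓ<q q≤n)

    -- Traces only move up or right, so once beyond the rectangle they never return to it.
    Beyond : ℕ → ℕ → Set
    Beyond r c = r ≤ i₀ ⊎ q < c

    beyond-outside : ∀ {r c} → Beyond (suc r) c → Outside (suc r , c)
    beyond-outside (inj₁ r≤) (inj₁ refl , _) = <-irrefl refl r≤
    beyond-outside (inj₁ r≤) (inj₂ refl , _) = <-irrefl refl (<-trans r≤ (n<1+n _))
    beyond-outside (inj₂ q<c) (_ , _ , c≤q) = <⇒≱ q<c c≤q

    beyond-right : ∀ {r c} → Beyond (suc r) c → Beyond (suc r) (suc c)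
    beyond-right (inj₁ p) = inj₁ p
    beyond-right (inj₂ p) = inj₂ (<-trans p (n<1+n _))

    beyond-up : ∀ {r c} → Beyond (suc r) c → Beyond r c
    beyond-up (inj₁ p) = inj₁ (<⇒≤ p)
    beyond-up (inj₂ p) = inj₂ p

    mutual
      beyond-same : ∀ f r c d → Beyond r c → TG.tr f r c d ≡ TH.tr f r c d
      beyond-same zero r c d _ = refl
      beyond-same (suc f) zero c fromLeft _ = refl
      beyond-same (suc f) zero c fromBottom _ = refl
      beyond-same (suc f) (suc r) c d p with c ≤? n
      ... | no c≰n = trans (TG.tr-outside f r c d (≰⇒> c≰n)) (sym (TH.tr-outside f r c d (≰⇒> c≰n)))
      ... | yes c≤n = begin
          TG.tr (suc f) (suc r) c d
        ≡⟨ TG.tr-step f r c d c≤n ⟩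
          ((suc r , c) ∷ []) ◂ TG.next f r c (G (suc r) c) d
        ≡⟨ cong (((suc r , c) ∷ []) ◂_) (beyond-same-next f r c (G (suc r) c) d p) ⟩
          ((suc r , c) ∷ []) ◂ TH.next f r c (G (suc r) c) d
        ≡⟨ cong (λ b → ((suc r , c) ∷ []) ◂ TH.next f r c b d) (agree (suc r) c (beyond-outside p)) ⟩
          ((suc r , c) ∷ []) ◂ TH.next f r c (H (suc r) c) d
        ≡⟨ TH.tr-step f r c d c≤n ⟨
          TH.tr (suc f) (suc r) c d
        ∎ where open ≡-Reasoning

      beyond-same-next : ∀ f r c b d → Beyond (suc r) c → TG.next f r c b d ≡ TH.next f r c b d
      beyond-same-next f r c true  fromLeft   p = beyond-same f (suc r) (suc c) fromLeft (beyond-right p)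
      beyond-same-next f r c false fromLeft   p = beyond-same f r c fromBottom (beyond-up p)
      beyond-same-next f r c true  fromBottom p = beyond-same f r c fromBottom (beyond-up p)
      beyond-same-next f r c false fromBottom p = beyond-same f (suc r) (suc c) fromLeft (beyond-right p)

    mutual
      beyond-avoids : ∀ f r c d → Beyond r c → All Outside (proj₁ (TG.tr f r c d))
      beyond-avoids zero r c d _ = []
      beyond-avoids (suc f) zero c fromLeft _ = []
      beyond-avoids (suc f) zero c fromBottom _ = []
      beyond-avoids (suc f) (suc r) c d p with c ≤? n
      ... | no c≰n rewrite TG.tr-outside f r c d (≰⇒> c≰n) = []
      ... | yes c≤n rewrite TG.tr-step f r c d c≤n = beyond-outside p ∷ beyond-avoids-next f r c (G (suc r) c) d p

      beyond-avoids-next : ∀ f r c b d → Beyond (suc r) c → All Outside (proj₁ (TG.next f r c b d))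
      beyond-avoids-next f r c true  fromLeft   p = beyond-avoids f (suc r) (suc c) fromLeft (beyond-right p)
      beyond-avoids-next f r c false fromLeft   p = beyond-avoids f r c fromBottom (beyond-up p)
      beyond-avoids-next f r c true  fromBottom p = beyond-avoids f r c fromBottom (beyond-up p)
      beyond-avoids-next f r c false fromBottom p = beyond-avoids f (suc r) (suc c) fromLeft (beyond-right p)

    -- The ways a pipe can enter the rectangle, and its route through it in G and in H
    -- up to the point where it leaves the rectangle for good.
    data Entry : Set where
      upperLeft lowerLeft bottomLeft bottomRight : Entry
      bottomMid : (c : ℕ) → ℓ < c → c < q → Entry

    column : ℕ → List Box
    column c = (suc i , c) ∷ (i , c) ∷ []

    routeG routeH : Entry → List Box
    routeG upperLeft = UL ∷ []
    routeG lowerLeft = lowerRoute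
    routeG bottomLeft = upperRoute
    routeG bottomRight = LR ∷ []
    routeG (bottomMid c _ _) = column c
    routeH upperLeft = UL ∷ []
    routeH lowerLeft = upperRoute
    routeH bottomLeft = lowerRoute
    routeH bottomRight = LR ∷ []
    routeH (bottomMid c _ _) = column c

    data Related : Trace → Trace → Set where
      same   : ∀ {P x} → All Outside P → Related (P , x) (P , x)
      detour : ∀ {A P x} (e : Entry) → All Outside A → All Outside P →
               Related (A ++ routeG e ++ P , x) (A ++ routeH e ++ P , x)

    related-∷ : ∀ b {R R′} → Outside b → Related R R′ → Related ((b ∷ []) ◂ R) ((b ∷ []) ◂ R′)
    related-∷ b o (same p) = same (o ∷ p)
    related-∷ b o (detour e a p) = detour e (o ∷ a) p

    related-entry : ∀ e {TG₀ TH₀} f r c d → Beyond r c →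
      TG₀ ≡ routeG e ◂ TG.tr f r c d → TH₀ ≡ routeH e ◂ TH.tr f r c d → Related TG₀ TH₀
    related-entry e f r c d p eG eH rewrite eG | eH | sym (beyond-same f r c d p) = detour e [] (beyond-avoids f r c d p)

    related-upperLeft : ∀ f → Related (TG.tr (suc f) i ℓ fromLeft) (TH.tr (suc f) i ℓ fromLeft)
    related-upperLeft f = related-entry upperLeft f i₀ ℓ fromBottom (inj₁ ≤-refl)
      (TG.elbow-fromLeft f i₀ ℓ G↑ℓ ℓ≤n) (TH.elbow-fromLeft f i₀ ℓ H↑ℓ ℓ≤n)

    related-lowerLeft : ∀ f → Related (TG.tr (3 + k + f) (suc i) ℓ fromLeft) (TH.tr (3 + k + f) (suc i) ℓ fromLeft)
    related-lowerLeft f = related-entry lowerLeft f i (suc q) fromLeft (inj₂ (n<1+n q))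
      (subst (λ b → TG.tr (3 + k + f) (suc i) ℓ fromLeft ≡ lowerRoute ◂ TG.next f i₀ q b fromBottom) G↑q (RG.lowerRoute-fromLeft G↓mid G↓q G↓ℓ f))
      (subst (λ b → TH.tr (3 + k + f) (suc i) ℓ fromLeft ≡ upperRoute ◂ TH.next f i₀ q b fromLeft) H↑q (RH.upperRoute-fromLeft H↑ℓ H↑mid H↓ℓ f))

    related-bottomLeft : ∀ f → Related (TG.tr (3 + k + f) (suc i) ℓ fromBottom) (TH.tr (3 + k + f) (suc i) ℓ fromBottom)
    related-bottomLeft f = related-entry bottomLeft f i₀ q fromBottom (inj₁ ≤-refl)
      (subst (λ b → TG.tr (3 + k + f) (suc i) ℓ fromBottom ≡ upperRoute ◂ TG.next f i₀ q b fromLeft) G↑q (RG.upperRoute-fromBottom G↑ℓ G↑mid G↓ℓ f))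
      (subst (λ b → TH.tr (3 + k + f) (suc i) ℓ fromBottom ≡ lowerRoute ◂ TH.next f i₀ q b fromBottom) H↑q (RH.lowerRoute-fromBottom H↓mid H↓q H↓ℓ f))

    related-bottomRight : ∀ f → Related (TG.tr (suc f) (suc i) q fromBottom) (TH.tr (suc f) (suc i) q fromBottom)
    related-bottomRight f = related-entry bottomRight f (suc i) (suc q) fromLeft (inj₂ (n<1+n q))
      (TG.elbow-fromBottom f i q G↓q q≤n) (TH.elbow-fromBottom f i q H↓q q≤n)

    related-bottomMid : ∀ f c (ℓ<c : ℓ < c) (c<q : c < q) →
      Related (TG.tr (2 + f) (suc i) c fromBottom) (TH.tr (2 + f) (suc i) c fromBottom)
    related-bottomMid f c ℓ<c c<q = related-entry (bottomMid c ℓ<c c<q) f i₀ c fromBottom (inj₁ ≤-refl)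
      (trans (TG.cross-fromBottom (suc f) i c (G↓mid c ℓ<c c<q) c≤n)
        (cong (((suc i , c) ∷ []) ◂_) (TG.cross-fromBottom f i₀ c (G↑mid c ℓ<c c<q) c≤n)))
      (trans (TH.cross-fromBottom (suc f) i c (H↓mid c ℓ<c c<q) c≤n)
        (cong (((suc i , c) ∷ []) ◂_) (TH.cross-fromBottom f i₀ c (H↑mid c ℓ<c c<q) c≤n)))
      where c≤n = <⇒≤ (<-≤-trans c<q q≤n)

    EntersFromBoundary : ℕ → ℕ → Dir → Set
    EntersFromBoundary r c d = Inside (r , c) → (d ≡ fromLeft × c ≡ ℓ) ⊎ (d ≡ fromBottom × r ≡ suc i)

    entersFromBoundary-right : ∀ {r c} → Outside (suc r , c) → EntersFromBoundary (suc r) (suc c) fromLeft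
    entersFromBoundary-right {r} {c} o (rows , ℓ≤ , ≤q) with ℓ ≤? c
    ... | yes ℓ≤c = ⊥-elim (o (rows , ℓ≤c , <⇒≤ ≤q))
    ... | no ℓ≰c = inj₁ (refl , sym (≤-antisym ℓ≤ (≰⇒> ℓ≰c)))

    entersFromBoundary-up : ∀ {r c} → Outside (suc r , c) → EntersFromBoundary r c fromBottom
    entersFromBoundary-up o (inj₁ refl , cs) = ⊥-elim (o (inj₂ refl , cs))
    entersFromBoundary-up o (inj₂ refl , cs) = inj₂ (refl , refl)

    with-fuel : ∀ {P : ℕ → Set} m F → m ≤ F → (∀ f → P (m + f)) → P F
    with-fuel {P} m F m≤F p = subst P (m+[n∸m]≡n m≤F) (p (F ∸ m))

    mutual
      traces-related : ∀ f r c d → EntersFromBoundary r c d → r + n ≤ f + c → Related (TG.tr f r c d) (TH.tr f r c d)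
      traces-related zero r c d _ _ = same []
      traces-related (suc f) zero c fromLeft _ _ = same []
      traces-related (suc f) zero c fromBottom _ _ = same []
      traces-related (suc f) (suc r) c d enters fuel with c ≤? n
      ... | no c≰n = subst₂ Related (sym (TG.tr-outside f r c d (≰⇒> c≰n))) (sym (TH.tr-outside f r c d (≰⇒> c≰n))) (same [])
      ... | yes c≤n with inRect? i ℓ q (suc r) c
      ...   | no out = subst₂ Related (sym (TG.tr-step f r c d c≤n))
                   (sym (trans (TH.tr-step f r c d c≤n) (cong (λ b → ((suc r , c) ∷ []) ◂ TH.next f r c b d) (sym (agree (suc r) c out)))))
                   (related-∷ (suc r , c) out (next-related f r c (G (suc r) c) d out fuel))
      ...   | yes inside with enters inside | proj₁ inside
      ...     | inj₁ (refl , refl) | inj₁ refl = related-upperLeft f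
      ...     | inj₁ (refl , refl) | inj₂ refl = with-fuel {λ F → Related (TG.tr F (suc i) ℓ fromLeft) (TH.tr F (suc i) ℓ fromLeft)}
                                                    (3 + k) (suc f) (rectangle-fuel (suc f) q≤n fuel) related-lowerLeft
      ...     | inj₂ (refl , refl) | _ with ℓ ≟ c | c ≟ q
      ...       | yes refl | _ = with-fuel {λ F → Related (TG.tr F (suc i) ℓ fromBottom) (TH.tr F (suc i) ℓ fromBottom)}
                                    (3 + k) (suc f) (rectangle-fuel (suc f) q≤n fuel) related-bottomLeft
      ...       | no _ | yes refl = related-bottomRight f
      ...       | no ℓ≢c | no c≢q with f
      ...         | zero = ⊥-elim (<⇒≱ (s≤s (s≤s (m≤n+m n i₀))) (≤-trans fuel (s≤s c≤n)))
      ...         | suc f′ = related-bottomMid f′ c (≤∧≢⇒< (proj₁ (proj₂ inside)) ℓ≢c) (≤∧≢⇒< (proj₂ (proj₂ inside)) c≢q)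

      next-related : ∀ f r c b d → Outside (suc r , c) → suc r + n ≤ suc f + c →
        Related (TG.next f r c b d) (TH.next f r c b d)
      next-related f r c true  fromLeft   o fuel = traces-related f (suc r) (suc c) fromLeft (entersFromBoundary-right o) (subst (suc r + n ≤_) (sym (+-suc f c)) fuel)
      next-related f r c false fromLeft   o fuel = traces-related f r c fromBottom (entersFromBoundary-up o) (≤-pred fuel)
      next-related f r c true  fromBottom o fuel = traces-related f r c fromBottom (entersFromBoundary-up o) (≤-pred fuel)
      next-related f r c false fromBottom o fuel = traces-related f (suc r) (suc c) fromLeft (entersFromBoundary-right o) (subst (suc r + n ≤_) (sym (+-suc f c)) fuel)

    pipes-related : ∀ a → a ≤ n → Related (pipe n G a) (pipe n H a)
    pipes-related a a≤n = traces-related (suc (suc (n + n))) a 1 fromLeft enters fuel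
      where enters : EntersFromBoundary a 1 fromLeft
            enters (_ , ℓ≤1 , _) = inj₁ (refl , ≤-antisym 1≤ℓ ℓ≤1)
            fuel : a + n ≤ suc (suc (n + n)) + 1
            fuel = ≤-trans (+-monoˡ-≤ n a≤n) (≤-trans (m≤n+m (n + n) 3) (≤-reflexive (cong (suc ∘ suc) (sym (+-comm (n + n) 1)))))

    lowerRoute-∈⁻ : ∀ {b} → b ∈ lowerRoute → (proj₁ b ≡ suc i × ℓ ≤ proj₂ b × proj₂ b ≤ q) ⊎ b ≡ UR
    lowerRoute-∈⁻ (here refl) = inj₁ (refl , ≤-refl , <⇒≤ ℓ<q)
    lowerRoute-∈⁻ (there p) with ∈-++⁻ lowerMid p
    ... | inj₁ m = let (r , a , c) = ∈-rowSeg⁻ m in inj₁ (r , <⇒≤ a , <⇒≤ c)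
    ... | inj₂ (here refl) = inj₁ (refl , <⇒≤ ℓ<q , ≤-refl)
    ... | inj₂ (there (here refl)) = inj₂ refl

    upperRoute-∈⁻ : ∀ {b} → b ∈ upperRoute → b ≡ LL ⊎ (proj₁ b ≡ i × ℓ ≤ proj₂ b × proj₂ b ≤ q)
    upperRoute-∈⁻ (here refl) = inj₁ refl
    upperRoute-∈⁻ (there (here refl)) = inj₂ (refl , ≤-refl , <⇒≤ ℓ<q)
    upperRoute-∈⁻ (there (there p)) with ∈-++⁻ upperMid p
    ... | inj₁ m = let (r , a , c) = ∈-rowSeg⁻ m in inj₂ (r , <⇒≤ a , <⇒≤ c)
    ... | inj₂ (here refl) = inj₂ (refl , <⇒≤ ℓ<q , ≤-refl)

    routeG-inside : ∀ e {b} → b ∈ routeG e → Inside b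
    routeG-inside upperLeft (here refl) = inj₁ refl , ≤-refl , <⇒≤ ℓ<q
    routeG-inside lowerLeft p with lowerRoute-∈⁻ p
    ... | inj₁ (refl , a , c) = inj₂ refl , a , c
    ... | inj₂ refl = inj₁ refl , <⇒≤ ℓ<q , ≤-refl
    routeG-inside bottomLeft p with upperRoute-∈⁻ p
    ... | inj₁ refl = inj₂ refl , ≤-refl , <⇒≤ ℓ<q
    ... | inj₂ (refl , a , c) = inj₁ refl , a , c
    routeG-inside bottomRight (here refl) = inj₂ refl , <⇒≤ ℓ<q , ≤-refl
    routeG-inside (bottomMid c ℓ<c c<q) (here refl) = inj₂ refl , <⇒≤ ℓ<c , <⇒≤ c<q
    routeG-inside (bottomMid c ℓ<c c<q) (there (here refl)) = inj₁ refl , <⇒≤ ℓ<c , <⇒≤ c<q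
    routeH-inside : ∀ e {b} → b ∈ routeH e → Inside b
    routeH-inside upperLeft = routeG-inside upperLeft
    routeH-inside lowerLeft = routeG-inside bottomLeft
    routeH-inside bottomLeft = routeG-inside lowerLeft
    routeH-inside bottomRight = routeG-inside bottomRight
    routeH-inside (bottomMid c ℓ<c c<q) = routeG-inside (bottomMid c ℓ<c c<q)

    LL∉column : ∀ c → ℓ < c → memBox LL (column c) ≡ false
    LL∉column c ℓ<c = memBox-∉ {LL} {column c} (λ { (here refl) → <-irrefl refl ℓ<c ; (there (here ())) })

    UR∉column : ∀ c → c < q → memBox UR (column c) ≡ false
    UR∉column c c<q = memBox-∉ {UR} {column c} (λ { (here ()) ; (there (here refl)) → <-irrefl refl c<q })

    UR∈lowerRoute : memBox UR lowerRoute ≡ true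
    UR∈lowerRoute = memBox-∈ {UR} {lowerRoute} (there (∈-++⁺ʳ lowerMid (there (here refl))))

    UR∈upperRoute : memBox UR upperRoute ≡ true
    UR∈upperRoute = memBox-∈ {UR} {upperRoute} (there (there (∈-++⁺ʳ upperMid (here refl))))

    lower∈lowerRoute : ∀ y → ℓ < y → y < q → memBox (suc i , y) lowerRoute ≡ true
    lower∈lowerRoute y ℓ<y y<q = memBox-∈ {suc i , y} {lowerRoute} (there (∈-++⁺ˡ (∈-rowSeg⁺ ℓ<y y<q)))

    lower∉upperRoute : ∀ y → ℓ < y → memBox (suc i , y) upperRoute ≡ false
    lower∉upperRoute y ℓ<y = memBox-∉ {suc i , y} {upperRoute} λ p → impossible (upperRoute-∈⁻ p)
      where impossible : (suc i , y) ≡ LL ⊎ (suc i ≡ i × ℓ ≤ y × y ≤ q) → ⊥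
            impossible (inj₁ refl) = <-irrefl refl ℓ<y
            impossible (inj₂ (() , _))

    upper∉lowerRoute : ∀ y → y < q → memBox (i , y) lowerRoute ≡ false
    upper∉lowerRoute y y<q = memBox-∉ {i , y} {lowerRoute} λ p → impossible (lowerRoute-∈⁻ p)
      where impossible : (i ≡ suc i × ℓ ≤ y × y ≤ q) ⊎ (i , y) ≡ UR → ⊥
            impossible (inj₁ (() , _))
            impossible (inj₂ refl) = <-irrefl refl y<q

    upper∈upperRoute : ∀ y → ℓ < y → y < q → memBox (i , y) upperRoute ≡ true
    upper∈upperRoute y ℓ<y y<q = memBox-∈ {i , y} {upperRoute} (there (there (∈-++⁺ˡ (∈-rowSeg⁺ ℓ<y y<q))))

    column-∈ : ∀ c r y → r ≡ i ⊎ r ≡ suc i → memBox (r , y) (column c) ≡ (y ≡ᵇ c)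
    column-∈ c r y (inj₁ refl) rewrite ≡ᵇ-refl i | ≡ᵇ-false {i} {suc i} (λ ()) with y ≡ᵇ c
    ... | true = refl
    ... | false = refl
    column-∈ c r y (inj₂ refl) rewrite ≡ᵇ-refl (suc i) | ≡ᵇ-false {suc i} {i} (λ ()) with y ≡ᵇ c
    ... | true = refl
    ... | false = refl

    rowSeg-full : ∀ (K : Grid) r → (∀ y → ℓ < y → y < q → K r y ≡ true) → ∀ {b} → b ∈ rowSeg r (suc ℓ) k → K (proj₁ b) (proj₂ b) ≡ true
    rowSeg-full K r full {x , y} m with ∈-rowSeg⁻ m
    ... | refl , ℓ<y , y<q = full y ℓ<y y<q

    module _ (Q : List Box) where

      crossCount-G-lowerRoute : crossCount G Q lowerRoute ≡ indicator (memBox LL Q) + memberCount Q lowerMid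
      crossCount-G-lowerRoute
        rewrite crossCount-cross G Q (suc i) ℓ (lowerMid ++ LR ∷ UR ∷ []) G↓ℓ | crossCount-++ G Q lowerMid (LR ∷ UR ∷ [])
              | crossCount-allCrosses G Q lowerMid (rowSeg-full G (suc i) G↓mid)
              | crossCount-elbow G Q (suc i) q (UR ∷ []) G↓q | crossCount-elbow G Q i q [] G↑q
        = cong (indicator (memBox LL Q) +_) (+-identityʳ _)

      crossCount-H-lowerRoute : crossCount H Q lowerRoute ≡ memberCount Q lowerMid + indicator (memBox UR Q)
      crossCount-H-lowerRoute
        rewrite crossCount-elbow H Q (suc i) ℓ (lowerMid ++ LR ∷ UR ∷ []) H↓ℓ | crossCount-++ H Q lowerMid (LR ∷ UR ∷ [])
              | crossCount-allCrosses H Q lowerMid (rowSeg-full H (suc i) H↓mid)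
              | crossCount-elbow H Q (suc i) q (UR ∷ []) H↓q | crossCount-cross H Q i q [] H↑q
        = cong (memberCount Q lowerMid +_) (+-identityʳ _)

      crossCount-G-upperRoute : crossCount G Q upperRoute ≡ indicator (memBox LL Q) + memberCount Q upperMid
      crossCount-G-upperRoute
        rewrite crossCount-cross G Q (suc i) ℓ (UL ∷ upperMid ++ UR ∷ []) G↓ℓ
              | crossCount-elbow G Q i ℓ (upperMid ++ UR ∷ []) G↑ℓ | crossCount-++ G Q upperMid (UR ∷ [])
              | crossCount-allCrosses G Q upperMid (rowSeg-full G i G↑mid)
              | crossCount-elbow G Q i q [] G↑q
        = cong (indicator (memBox LL Q) +_) (+-identityʳ _)

      crossCount-H-upperRoute : crossCount H Q upperRoute ≡ memberCount Q upperMid + indicator (memBox UR Q)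
      crossCount-H-upperRoute
        rewrite crossCount-elbow H Q (suc i) ℓ (UL ∷ upperMid ++ UR ∷ []) H↓ℓ
              | crossCount-elbow H Q i ℓ (upperMid ++ UR ∷ []) H↑ℓ | crossCount-++ H Q upperMid (UR ∷ [])
              | crossCount-allCrosses H Q upperMid (rowSeg-full H i H↑mid)
              | crossCount-cross H Q i q [] H↑q
        = cong (memberCount Q upperMid +_) (+-identityʳ _)

      crossCount-column : ∀ K c → K (suc i) c ≡ true → K i c ≡ true →
        crossCount K Q (column c) ≡ indicator (memBox (suc i , c) Q) + indicator (memBox (i , c) Q)
      crossCount-column K c K↓c K↑c rewrite crossCount-cross K Q (suc i) c ((i , c) ∷ []) K↓c | crossCount-cross K Q i c [] K↑c
        = cong (indicator (memBox (suc i , c) Q) +_) (+-identityʳ _)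

    LL∈lowerRoute : memBox LL lowerRoute ≡ true
    LL∈lowerRoute = memBox-∈ {LL} {lowerRoute} (here refl)

    LL∈upperRoute : memBox LL upperRoute ≡ true
    LL∈upperRoute = memBox-∈ {LL} {upperRoute} (here refl)

    lowerMid-on-lowerRoute : memberCount lowerRoute lowerMid ≡ k
    lowerMid-on-lowerRoute = memberCount-all lowerRoute (suc i) (suc ℓ) k lower∈lowerRoute

    lowerMid-on-upperRoute : memberCount upperRoute lowerMid ≡ 0
    lowerMid-on-upperRoute = memberCount-none upperRoute (suc i) (suc ℓ) k (λ y ℓ<y _ → lower∉upperRoute y ℓ<y)

    upperMid-on-lowerRoute : memberCount lowerRoute upperMid ≡ 0
    upperMid-on-lowerRoute = memberCount-none lowerRoute i (suc ℓ) k (λ y _ y<q → upper∉lowerRoute y y<q)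

    upperMid-on-upperRoute : memberCount upperRoute upperMid ≡ k
    upperMid-on-upperRoute = memberCount-all upperRoute i (suc ℓ) k upper∈upperRoute

    lowerMid-on-column : ∀ c → ℓ < c → c < q → memberCount (column c) lowerMid ≡ 1
    lowerMid-on-column c ℓ<c c<q = memberCount-one (column c) (suc i) (suc ℓ) k c ℓ<c c<q (λ y _ _ → column-∈ c (suc i) y (inj₂ refl))

    upperMid-on-column : ∀ c → ℓ < c → c < q → memberCount (column c) upperMid ≡ 1
    upperMid-on-column c ℓ<c c<q = memberCount-one (column c) i (suc ℓ) k c ℓ<c c<q (λ y _ _ → column-∈ c i y (inj₁ refl))

    -- Between the lower and the upper route, the k middle crossings and the
    -- corner crossing at LL or UR trade places.
    local-crossings : ∀ e e′ → crossCount G (routeG e′) (routeG e) ≡ crossCount H (routeH e′) (routeH e)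
    local-crossings upperLeft e′ = trans (crossCount-elbow G (routeG e′) i ℓ [] G↑ℓ) (sym (crossCount-elbow H (routeH e′) i ℓ [] H↑ℓ))
    local-crossings bottomRight e′ = trans (crossCount-elbow G (routeG e′) (suc i) q [] G↓q) (sym (crossCount-elbow H (routeH e′) (suc i) q [] H↓q))
    local-crossings lowerLeft upperLeft = trans (crossCount-elbowPath G UL lowerRoute G↑ℓ) (sym (crossCount-elbowPath H UL upperRoute H↑ℓ))
    local-crossings bottomLeft upperLeft = trans (crossCount-elbowPath G UL upperRoute G↑ℓ) (sym (crossCount-elbowPath H UL lowerRoute H↑ℓ))
    local-crossings (bottomMid c _ _) upperLeft = trans (crossCount-elbowPath G UL (column c) G↑ℓ) (sym (crossCount-elbowPath H UL (column c) H↑ℓ))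
    local-crossings lowerLeft bottomRight = trans (crossCount-elbowPath G LR lowerRoute G↓q) (sym (crossCount-elbowPath H LR upperRoute H↓q))
    local-crossings bottomLeft bottomRight = trans (crossCount-elbowPath G LR upperRoute G↓q) (sym (crossCount-elbowPath H LR lowerRoute H↓q))
    local-crossings (bottomMid c _ _) bottomRight = trans (crossCount-elbowPath G LR (column c) G↓q) (sym (crossCount-elbowPath H LR (column c) H↓q))
    local-crossings lowerLeft lowerLeft
      rewrite crossCount-G-lowerRoute lowerRoute | crossCount-H-upperRoute upperRoute | LL∈lowerRoute | UR∈upperRoute
            | lowerMid-on-lowerRoute | upperMid-on-upperRoute = +-comm 1 k
    local-crossings lowerLeft bottomLeft
      rewrite crossCount-G-lowerRoute upperRoute | crossCount-H-upperRoute lowerRoute | LL∈upperRoute | UR∈lowerRoute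
            | lowerMid-on-upperRoute | upperMid-on-lowerRoute = refl
    local-crossings lowerLeft (bottomMid c ℓ<c c<q)
      rewrite crossCount-G-lowerRoute (column c) | crossCount-H-upperRoute (column c) | LL∉column c ℓ<c | UR∉column c c<q
            | lowerMid-on-column c ℓ<c c<q | upperMid-on-column c ℓ<c c<q = refl
    local-crossings bottomLeft lowerLeft
      rewrite crossCount-G-upperRoute lowerRoute | crossCount-H-lowerRoute upperRoute | LL∈lowerRoute | UR∈upperRoute
            | upperMid-on-lowerRoute | lowerMid-on-upperRoute = refl
    local-crossings bottomLeft bottomLeft
      rewrite crossCount-G-upperRoute upperRoute | crossCount-H-lowerRoute lowerRoute | LL∈upperRoute | UR∈lowerRoute
            | upperMid-on-upperRoute | lowerMid-on-lowerRoute = +-comm 1 k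
    local-crossings bottomLeft (bottomMid c ℓ<c c<q)
      rewrite crossCount-G-upperRoute (column c) | crossCount-H-lowerRoute (column c) | LL∉column c ℓ<c | UR∉column c c<q
            | upperMid-on-column c ℓ<c c<q | lowerMid-on-column c ℓ<c c<q = refl
    local-crossings (bottomMid c ℓ<c c<q) lowerLeft
      rewrite crossCount-column lowerRoute G c (G↓mid c ℓ<c c<q) (G↑mid c ℓ<c c<q)
            | crossCount-column upperRoute H c (H↓mid c ℓ<c c<q) (H↑mid c ℓ<c c<q)
            | lower∈lowerRoute c ℓ<c c<q | upper∉lowerRoute c c<q | lower∉upperRoute c ℓ<c | upper∈upperRoute c ℓ<c c<q = refl
    local-crossings (bottomMid c ℓ<c c<q) bottomLeft
      rewrite crossCount-column upperRoute G c (G↓mid c ℓ<c c<q) (G↑mid c ℓ<c c<q)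
            | crossCount-column lowerRoute H c (H↓mid c ℓ<c c<q) (H↑mid c ℓ<c c<q)
            | lower∈lowerRoute c ℓ<c c<q | upper∉lowerRoute c c<q | lower∉upperRoute c ℓ<c | upper∈upperRoute c ℓ<c c<q = refl
    local-crossings (bottomMid c ℓ<c c<q) (bottomMid c′ _ _) =
      trans (crossCount-column (column c′) G c (G↓mid c ℓ<c c<q) (G↑mid c ℓ<c c<q))
            (sym (crossCount-column (column c′) H c (H↓mid c ℓ<c c<q) (H↑mid c ℓ<c c<q)))

    related-exit : ∀ {R R′} → Related R R′ → proj₂ R ≡ proj₂ R′
    related-exit (same _) = refl
    related-exit (detour _ _ _) = refl

    ∉-outsiders : ∀ {b L} → All Outside L → Inside b → memBox b L ≡ false
    ∉-outsiders {b} os inside = memBox-∉ (lemma os)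
      where lemma : ∀ {L} → All Outside L → b ∈ L → ⊥
            lemma (o ∷ _) (here refl) = o inside
            lemma (_ ∷ os) (there p) = lemma os p

    inner : ∀ {R R′} → Related R R′ → List Box × List Box
    inner (same _) = [] , []
    inner (detour e _ _) = routeG e , routeH e

    memBox-++₃ : ∀ b A S P → memBox b (A ++ S ++ P) ≡ memBox b A ∨ (memBox b S ∨ memBox b P)
    memBox-++₃ b A S P rewrite memBox-++ b A (S ++ P) | memBox-++ b S P = refl

    memBox-inside : ∀ {R R′} (r : Related R R′) b → Inside b →
      memBox b (proj₁ R) ≡ memBox b (proj₁ (inner r)) × memBox b (proj₁ R′) ≡ memBox b (proj₂ (inner r))
    memBox-inside (same os) b inside = ∉-outsiders os inside , ∉-outsiders os inside
    memBox-inside (detour {A} {P} e oA oP) b inside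
      rewrite memBox-++₃ b A (routeG e) P | memBox-++₃ b A (routeH e) P
            | ∉-outsiders {b} oA inside | ∉-outsiders {b} oP inside
            | ∨-identityʳ (memBox b (routeG e)) | ∨-identityʳ (memBox b (routeH e)) = refl , refl

    memBox-outside : ∀ {R R′} → Related R R′ → ∀ b → Outside b → memBox b (proj₁ R) ≡ memBox b (proj₁ R′)
    memBox-outside (same _) b o = refl
    memBox-outside (detour {A} {P} e oA oP) b o
      rewrite memBox-++₃ b A (routeG e) P | memBox-++₃ b A (routeH e) P
            | memBox-∉ {b} {routeG e} (o ∘ routeG-inside e) | memBox-∉ {b} {routeH e} (o ∘ routeH-inside e) = refl

    agree-outsiders : ∀ {L} → All Outside L → ∀ {b} → b ∈ L → G (proj₁ b) (proj₂ b) ≡ H (proj₁ b) (proj₂ b)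
    agree-outsiders (o ∷ _) (here refl) = agree _ _ o
    agree-outsiders (_ ∷ os) (there p) = agree-outsiders os p

    memBox-outsiders : ∀ {L R R′} → All Outside L → Related R R′ → ∀ {b} → b ∈ L → memBox b (proj₁ R) ≡ memBox b (proj₁ R′)
    memBox-outsiders (o ∷ _) r (here refl) = memBox-outside r _ o
    memBox-outsiders (_ ∷ os) r (there p) = memBox-outsiders os r p

    crossCount-route : ∀ e {R R′} (r : Related R R′) → crossCount G (proj₁ R) (routeG e) ≡ crossCount H (proj₁ R′) (routeH e)
    crossCount-route e {R} {R′} r = begin
        crossCount G (proj₁ R) (routeG e)
      ≡⟨ crossCount-cong G G _ _ (routeG e) (λ _ → refl) (λ {b} p → proj₁ (memBox-inside r b (routeG-inside e p))) ⟩
        crossCount G (proj₁ (inner r)) (routeG e)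
      ≡⟨ inner-crossings r ⟩
        crossCount H (proj₂ (inner r)) (routeH e)
      ≡⟨ crossCount-cong H H _ _ (routeH e) (λ _ → refl) (λ {b} p → proj₂ (memBox-inside r b (routeH-inside e p))) ⟨
        crossCount H (proj₁ R′) (routeH e)
      ∎
      where
      open ≡-Reasoning
      inner-crossings : ∀ {R R′} (r : Related R R′) → crossCount G (proj₁ (inner r)) (routeG e) ≡ crossCount H (proj₂ (inner r)) (routeH e)
      inner-crossings (same _) = trans (crossCount-[] G (routeG e)) (sym (crossCount-[] H (routeH e)))
      inner-crossings (detour e′ _ _) = local-crossings e e′

    related-crossings : ∀ {Ra Ra′ Rb Rb′} → Related Ra Ra′ → Related Rb Rb′ →
      crossCount G (proj₁ Rb) (proj₁ Ra) ≡ crossCount H (proj₁ Rb′) (proj₁ Ra′)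
    related-crossings (same os) rb = crossCount-cong G H _ _ _ (agree-outsiders os) (memBox-outsiders os rb)
    related-crossings {Rb = Rb} {Rb′ = Rb′} (detour {A} {P} e oA oP) rb
      rewrite crossCount-++ G (proj₁ Rb) A (routeG e ++ P) | crossCount-++ G (proj₁ Rb) (routeG e) P
            | crossCount-++ H (proj₁ Rb′) A (routeH e ++ P) | crossCount-++ H (proj₁ Rb′) (routeH e) P
            | crossCount-cong G H (proj₁ Rb) (proj₁ Rb′) A (agree-outsiders oA) (memBox-outsiders oA rb)
            | crossCount-cong G H (proj₁ Rb) (proj₁ Rb′) P (agree-outsiders oP) (memBox-outsiders oP rb)
            | crossCount-route e rb = refl

    exit-preserved : ∀ a → a ≤ n → proj₂ (pipe n G a) ≡ proj₂ (pipe n H a)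
    exit-preserved a a≤n = related-exit (pipes-related a a≤n)

    crossings-preserved : ∀ a b → a ≤ n → b ≤ n → crossings n G a b ≡ crossings n H a b
    crossings-preserved a b a≤n b≤n = begin
        crossings n G a b
      ≡⟨ crossings≡crossCount n G a b ⟩
        crossCount G (proj₁ (pipe n G b)) (proj₁ (pipe n G a))
      ≡⟨ related-crossings (pipes-related a a≤n) (pipes-related b b≤n) ⟩
        crossCount H (proj₁ (pipe n H b)) (proj₁ (pipe n H a))
      ≡⟨ crossings≡crossCount n H a b ⟨
        crossings n H a b
      ∎ where open ≡-Reasoning

  ∸-suc : ∀ {r m} → r < m → m ∸ r ≡ suc (m ∸ suc r)
  ∸-suc {zero} {suc m} _ = refl
  ∸-suc {suc r} {suc m} (s≤s r<m) = ∸-suc r<m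

  module BackwardTracing (n : ℕ) (D : Grid) (D-pd : IsPipeDream n D) where

    open Tracing n D

    fuel : ℕ
    fuel = suc (suc (n + n))

    -- Each step lowers the row or raises the column by one, whence length≡.
    record Reaches (a r c : ℕ) (d : Dir) : Set where
      constructor reaches
      field
        pre     : List Box
        f       : ℕ
        trace≡  : tr fuel a 1 fromLeft ≡ pre ◂ tr f r c d
        length≡ : r + length pre + 1 ≡ a + c
        enough  : r + n + 1 ≤ f + c

    extend : ∀ {a r c d r′ c′ d′} (R : Reaches a r c d) b → c ≤ n →
      (∀ f → tr (suc f) r c d ≡ (b ∷ []) ◂ tr f r′ c′ d′) →
      r′ + suc (length (Reaches.pre R)) + 1 ≡ a + c′ →
      (∀ f → r + n + 1 ≤ suc f + c → r′ + n + 1 ≤ f + c′) → Reaches a r′ c′ d′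
    extend {r = r} (reaches pre zero _ _ enough) b c≤n _ _ _ =
      ⊥-elim (<⇒≱ (≤-<-trans c≤n (≤-<-trans (m≤n+m n r) (m<m+n (r + n) (s≤s z≤n)))) enough)
    extend {r′ = r′} {c′} {d′} (reaches pre (suc f) trace≡ length≡ enough) b _ step length≡′ enough′ =
      reaches (pre ++ b ∷ []) f
        (trans trace≡ (trans (cong (pre ◂_) (step f)) (◂-assoc pre (b ∷ []) (tr f r′ c′ d′))))
        (trans (cong (λ x → r′ + x + 1) (trans (length-++ pre) (+-comm (length pre) 1))) length≡′)
        (enough′ f enough)

    extend-right : ∀ {a r c d} (R : Reaches a (suc r) c d) → c ≤ n →
      (∀ f → tr (suc f) (suc r) c d ≡ ((suc r , c) ∷ []) ◂ tr f (suc r) (suc c) fromLeft) →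
      Reaches a (suc r) (suc c) fromLeft
    extend-right {a} {r} {c} R c≤n step = extend R _ c≤n step length≡′ fuel′
      where
      m = length (Reaches.pre R)
      length≡′ : suc r + suc m + 1 ≡ a + suc c
      length≡′ = trans (cong (_+ 1) (+-suc (suc r) m)) (trans (cong suc (Reaches.length≡ R)) (sym (+-suc a c)))
      fuel′ : ∀ f → suc r + n + 1 ≤ suc f + c → suc r + n + 1 ≤ f + suc c
      fuel′ f h = subst (suc r + n + 1 ≤_) (sym (+-suc f c)) h

    extend-up : ∀ {a r c d} (R : Reaches a (suc r) c d) → c ≤ n →
      (∀ f → tr (suc f) (suc r) c d ≡ ((suc r , c) ∷ []) ◂ tr f r c fromBottom) →
      Reaches a r c fromBottom
    extend-up {a} {r} {c} R c≤n step =
      extend R _ c≤n step (trans (cong (_+ 1) (+-suc r (length (Reaches.pre R)))) (Reaches.length≡ R)) (λ _ → ≤-pred)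

    down-step : ∀ r c t → suc r + suc c ≤ n → suc c + (n ∸ suc r) ≡ suc t → suc c + (n ∸ suc (suc r)) ≡ t
    down-step r c t r+c≤n t≡ = suc-injective (trans (sym (+-suc (suc c) (n ∸ suc (suc r))))
      (trans (cong (suc c +_) (sym (∸-suc r<n))) t≡))
      where r<n : suc r < n
            r<n = ≤-trans (s≤s (m≤m+n (suc r) c)) (subst (_≤ n) (+-suc (suc r) c) r+c≤n)

    Reached : ℕ → ℕ → Dir → Set
    Reached r c d = Σ ℕ λ a → (1 ≤ a) × (a ≤ n) × Reaches a r c d

    map-Reached : ∀ {r c d r′ c′ d′} → (∀ {a} → Reaches a r c d → Reaches a r′ c′ d′) → Reached r c d → Reached r′ c′ d′
    map-Reached g (a , 1≤a , a≤n , R) = a , 1≤a , a≤n , g R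

    reached : ∀ t r c d → c + (n ∸ r) ≡ t → 1 ≤ r → 1 ≤ c → r + c ≤ suc n → (d ≡ fromBottom → r + c ≤ n) →
      Reached r c d
    reached t (suc r) (suc zero) fromLeft _ _ _ r+c≤ _ =
      suc r , s≤s z≤n , r<n , reaches [] fuel refl (cong (_+ 1) (+-identityʳ (suc r)))
        (+-monoˡ-≤ 1 (≤-trans (+-monoˡ-≤ n r<n) (≤-trans (m≤n+m (n + n) 2) ≤-refl)))
      where r<n = ≤-pred (subst (_≤ suc n) (+-comm (suc r) 1) r+c≤)
    reached (suc t) (suc r) (suc (suc c)) fromLeft t≡ _ _ r+c≤ _ with D (suc r) (suc c) in tile
    ... | true = map-Reached (λ R → extend-right R c≤n (λ f → cross-fromLeft f r (suc c) tile c≤n))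
                   (reached t (suc r) (suc c) fromLeft (suc-injective t≡) (s≤s z≤n) (s≤s z≤n) r+c≤′ (λ ()))
      where c≤n = ≤-trans (n≤1+n (suc c)) (≤-trans (m≤n+m (suc (suc c)) r) (≤-pred r+c≤))
            r+c≤′ = ≤-trans (+-monoʳ-≤ (suc r) (n≤1+n (suc c))) r+c≤
    ... | false = map-Reached (λ R → extend-right R c≤n (λ f → elbow-fromBottom f r (suc c) tile c≤n))
                   (reached t (suc r) (suc c) fromBottom (suc-injective t≡) (s≤s z≤n) (s≤s z≤n) r+c≤′
                     (λ _ → ≤-pred (subst (_≤ suc n) (+-suc (suc r) (suc c)) r+c≤)))
      where c≤n = ≤-trans (n≤1+n (suc c)) (≤-trans (m≤n+m (suc (suc c)) r) (≤-pred r+c≤))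
            r+c≤′ = ≤-trans (+-monoʳ-≤ (suc r) (n≤1+n (suc c))) r+c≤
    reached (suc t) (suc r) (suc c) fromBottom t≡ _ _ _ r+c≤n with D (suc (suc r)) (suc c) in tile
    ... | true = map-Reached (λ R → extend-up R c≤n (λ f → cross-fromBottom f (suc r) (suc c) tile c≤n))
                   (reached t (suc (suc r)) (suc c) fromBottom t≡′ (s≤s z≤n) (s≤s z≤n) (s≤s (r+c≤n refl))
                     (λ _ → proj₂ (proj₂ (D-pd _ _ tile))))
      where c≤n = ≤-trans (m≤n+m (suc c) (suc r)) (r+c≤n refl)
            t≡′ = down-step r c t (r+c≤n refl) t≡
    ... | false = map-Reached (λ R → extend-up R c≤n (λ f → elbow-fromLeft f (suc r) (suc c) tile c≤n))
                   (reached t (suc (suc r)) (suc c) fromLeft t≡′ (s≤s z≤n) (s≤s z≤n) (s≤s (r+c≤n refl)) (λ ()))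
      where c≤n = ≤-trans (m≤n+m (suc c) (suc r)) (r+c≤n refl)
            t≡′ = down-step r c t (r+c≤n refl) t≡

  -- A reduced pipe dream has no cross at the far corner of a chute

  crossCount-≥2 : ∀ K Q A x B y C → (K (proj₁ x) (proj₂ x) ∧ memBox x Q) ≡ true →
    (K (proj₁ y) (proj₂ y) ∧ memBox y Q) ≡ true → 2 ≤ crossCount K Q (A ++ x ∷ B ++ y ∷ C)
  crossCount-≥2 K Q A x B y C x-shared y-shared
    rewrite crossCount-++ K Q A (x ∷ B ++ y ∷ C) | crossCount-∷ K Q x (B ++ y ∷ C) | x-shared
          | crossCount-++ K Q B (y ∷ C) | crossCount-∷ K Q y C | y-shared =
    ≤-trans (s≤s (s≤s z≤n)) (≤-trans (s≤s (m≤n+m (suc (crossCount K Q C)) (crossCount K Q B))) (m≤n+m _ (crossCount K Q A)))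

  ++-cancel-length : ∀ (A B X Y : List Box) → length A ≡ length B → A ++ X ≡ B ++ Y → X ≡ Y
  ++-cancel-length [] [] X Y _ e = e
  ++-cancel-length (a ∷ A) (b ∷ B) X Y l e = ++-cancel-length A B X Y (suc-injective l) (∷-injectiveʳ e)

  headRow : List Box → ℕ
  headRow [] = 0
  headRow ((r , _) ∷ _) = r

  headRow-rowSeg : ∀ r c m z M L → headRow ((rowSeg r c m ++ (r , z) ∷ M) ++ L) ≡ r
  headRow-rowSeg r c zero z M L = refl
  headRow-rowSeg r c (suc m) z M L = refl

  module CornerCross (n i₀ ℓ k : ℕ) (D : Grid) (D-pd : IsPipeDream n D) (D-reduced : Reduced n D)
    (1≤ℓ : 1 ≤ ℓ) (q≤n : suc ℓ + k ≤ n)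
    (D↑ℓ : D (suc i₀) ℓ ≡ false) (D↑mid : ∀ y → ℓ < y → y < suc ℓ + k → D (suc i₀) y ≡ true)
    (D↓ℓ : D (suc (suc i₀)) ℓ ≡ true) (D↓mid : ∀ y → ℓ < y → y < suc ℓ + k → D (suc (suc i₀)) y ≡ true)
    (D↓q : D (suc (suc i₀)) (suc ℓ + k) ≡ false) where

    open Rectangle i₀ ℓ k
    open Tracing n D
    open Routes i₀ ℓ k q≤n
    open BackwardTracing n D D-pd
    open Reaches

    path : ℕ → List Box
    path a = proj₁ (tr fuel a 1 fromLeft)

    i+ℓ≤n : suc i + ℓ ≤ n
    i+ℓ≤n = proj₂ (proj₂ (D-pd (suc i) ℓ D↓ℓ))

    through-LL : ∀ d → Reached (suc i) ℓ d
    through-LL d = reached _ (suc i) ℓ d refl (s≤s z≤n) 1≤ℓ (≤-trans i+ℓ≤n (n≤1+n n)) (λ _ → i+ℓ≤n)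

    enough-fuel : ∀ {a d} (R : Reaches a (suc i) ℓ d) → 3 + k ≤ f R
    enough-fuel R = rectangle-fuel (f R) q≤n (≤-trans (m≤m+n (suc i + n) 1) (enough R))

    refuel : ∀ {a d} (R : Reaches a (suc i) ℓ d) → tr (f R) (suc i) ℓ d ≡ tr (3 + k + (f R ∸ (3 + k))) (suc i) ℓ d
    refuel {d = d} R = cong (λ F → tr F (suc i) ℓ d) (sym (m+[n∸m]≡n (enough-fuel R)))

    path-lower : ∀ {a} (R : Reaches a (suc i) ℓ fromLeft) → Σ (List Box) λ rest → path a ≡ pre R ++ lowerRoute ++ rest
    path-lower R = _ , cong proj₁ (trans (trace≡ R) (cong (pre R ◂_)
      (trans (refuel R) (lowerRoute-fromLeft D↓mid D↓q D↓ℓ (f R ∸ (3 + k))))))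

    path-upper : ∀ {a} (R : Reaches a (suc i) ℓ fromBottom) → Σ (List Box) λ rest → path a ≡ pre R ++ upperRoute ++ rest
    path-upper R = _ , cong proj₁ (trans (trace≡ R) (cong (pre R ◂_)
      (trans (refuel R) (upperRoute-fromBottom D↑ℓ D↑mid D↓ℓ (f R ∸ (3 + k))))))

    -- A pipe visits LL only once, so it cannot enter it both from the left and from below.
    different-pipes : ∀ {a₁ a₂} → Reaches a₁ (suc i) ℓ fromLeft → Reaches a₂ (suc i) ℓ fromBottom → a₁ ≢ a₂
    different-pipes R₁ R₂ refl = 1+n≢n (begin
        suc i                                          ≡⟨ headRow-rowSeg (suc i) (suc ℓ) k q (UR ∷ []) rest₁ ⟨
        headRow ((lowerMid ++ LR ∷ UR ∷ []) ++ rest₁)  ≡⟨ cong headRow (∷-injectiveʳ routes≡) ⟩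
        headRow (UL ∷ upperMid ++ UR ∷ rest₂)          ≡⟨⟩
        i                                              ∎)
      where
      open ≡-Reasoning
      rest₁ = proj₁ (path-lower R₁)
      rest₂ = proj₁ (path-upper R₂)
      same-length : length (pre R₁) ≡ length (pre R₂)
      same-length = +-cancelˡ-≡ (suc i) _ _ (+-cancelʳ-≡ 1 _ _ (trans (length≡ R₁) (sym (length≡ R₂))))
      routes≡ : lowerRoute ++ rest₁ ≡ upperRoute ++ rest₂
      routes≡ = ++-cancel-length (pre R₁) (pre R₂) _ _ same-length
        (trans (sym (proj₂ (path-lower R₁))) (proj₂ (path-upper R₂)))

    no-corner-cross : D i q ≡ false
    no-corner-cross with D i q in D↑q
    ... | false = refl
    ... | true with through-LL fromLeft | through-LL fromBottom
    ...   | a₁ , 1≤a₁ , a₁≤n , R₁ | a₂ , 1≤a₂ , a₂≤n , R₂ = ⊥-elim (<⇒≱ two-crossings at-most-one)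
      where
      rest₁ = proj₁ (path-lower R₁)
      rest₂ = proj₁ (path-upper R₂)
      LL∈path₂ : LL ∈ path a₂
      LL∈path₂ = subst (LL ∈_) (sym (proj₂ (path-upper R₂))) (∈-++⁺ʳ (pre R₂) (here refl))
      UR∈path₂ : UR ∈ path a₂
      UR∈path₂ = subst (UR ∈_) (sym (proj₂ (path-upper R₂)))
        (∈-++⁺ʳ (pre R₂) (∈-++⁺ˡ (there (there (∈-++⁺ʳ upperMid (here refl))))))
      path₁≡ : path a₁ ≡ pre R₁ ++ LL ∷ (lowerMid ++ LR ∷ []) ++ UR ∷ rest₁
      path₁≡ = trans (proj₂ (path-lower R₁)) (cong (λ L → pre R₁ ++ LL ∷ L)
        (trans (++-assoc lowerMid (LR ∷ UR ∷ []) rest₁) (sym (++-assoc lowerMid (LR ∷ []) (UR ∷ rest₁)))))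
      two-crossings : 2 ≤ crossCount D (path a₂) (path a₁)
      two-crossings = subst (λ L → 2 ≤ crossCount D (path a₂) L) (sym path₁≡)
        (crossCount-≥2 D (path a₂) (pre R₁) LL (lowerMid ++ LR ∷ []) UR rest₁
          (cong₂ _∧_ D↓ℓ (memBox-∈ LL∈path₂)) (cong₂ _∧_ D↑q (memBox-∈ UR∈path₂)))
      fin : ∀ a → 1 ≤ a → a ≤ n → Σ (Fin n) λ x → suc (toℕ x) ≡ a
      fin (suc a) _ a≤n = fromℕ< a≤n , cong suc (toℕ-fromℕ< a≤n)
      x₁ = fin a₁ 1≤a₁ a₁≤n
      x₂ = fin a₂ 1≤a₂ a₂≤n
      at-most-one : crossCount D (path a₂) (path a₁) ≤ 1
      at-most-one = subst (_≤ 1) (trans (cong₂ (crossings n D) (proj₂ x₁) (proj₂ x₂)) (crossings≡crossCount n D a₁ a₂))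
        (D-reduced (proj₁ x₁) (proj₁ x₂)
          (λ x₁≡x₂ → different-pipes R₁ R₂ (trans (sym (proj₂ x₁)) (trans (cong (suc ∘ toℕ) x₁≡x₂) (proj₂ x₂)))))

  update-same : ∀ G a b v → update G a b v a b ≡ v
  update-same G a b v rewrite ≡ᵇ-refl a | ≡ᵇ-refl b = refl

  update-other : ∀ G a b v x y → ¬ (x ≡ a × y ≡ b) → update G a b v x y ≡ G x y
  update-other G a b v x y ne with x ≟ a | y ≟ b
  ... | yes refl | yes refl = ⊥-elim (ne (refl , refl))
  ... | no x≢a | _ rewrite ≡ᵇ-false x≢a = refl
  ... | yes refl | no y≢b rewrite ≡ᵇ-refl x | ≡ᵇ-false y≢b = refl

  moveCross : Grid → Box → Box → Grid
  moveCross G (a , b) (c , d) = update (update G a b false) c d true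

  module MoveCross (G : Grid) (a b c d : ℕ) (a≢c : a ≢ c) where

    moveCross-source : moveCross G (a , b) (c , d) a b ≡ false
    moveCross-source = trans (update-other (update G a b false) c d true a b (a≢c ∘ proj₁)) (update-same G a b false)

    moveCross-target : moveCross G (a , b) (c , d) c d ≡ true
    moveCross-target = update-same (update G a b false) c d true

    moveCross-other : ∀ x y → ¬ (x ≡ a × y ≡ b) → ¬ (x ≡ c × y ≡ d) → moveCross G (a , b) (c , d) x y ≡ G x y
    moveCross-other x y ≢ab ≢cd = trans (update-other (update G a b false) c d true x y ≢cd) (update-other G a b false x y ≢ab)

    moveCross-source-row : ∀ y → y ≢ b → moveCross G (a , b) (c , d) a y ≡ G a y
    moveCross-source-row y y≢b = moveCross-other a y (y≢b ∘ proj₂) (a≢c ∘ proj₁)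

    moveCross-target-row : ∀ y → y ≢ d → moveCross G (a , b) (c , d) c y ≡ G c y
    moveCross-target-row y y≢d = moveCross-other c y (a≢c ∘ sym ∘ proj₁) (y≢d ∘ proj₂)

    moveCross-undo : G a b ≡ true → G c d ≡ false → ∀ {G′} → moveCross G (a , b) (c , d) ≐ G′ →
      moveCross G′ (c , d) (a , b) ≐ G
    moveCross-undo Gab Gcd {G′} moved x y with x ≟ a | y ≟ b
    ... | yes refl | yes refl = trans (update-same (update G′ c d false) a b true) (sym Gab)
    ... | yes refl | no y≢b = trans (update-other (update G′ c d false) a b true a y (y≢b ∘ proj₂)) (trans
          (update-other G′ c d false a y (a≢c ∘ proj₁)) (trans (sym (moved a y)) (moveCross-source-row y y≢b)))
    ... | no x≢a | _ with x ≟ c | y ≟ d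
    ...   | yes refl | yes refl = trans (update-other (update G′ c d false) a b true c d (x≢a ∘ proj₁)) (trans (update-same G′ c d false) (sym Gcd))
    ...   | yes refl | no y≢d = trans (update-other (update G′ c d false) a b true c y (x≢a ∘ proj₁)) (trans
            (update-other G′ c d false c y (y≢d ∘ proj₂)) (trans (sym (moved c y)) (moveCross-target-row y y≢d)))
    ...   | no x≢c | _ = trans (update-other (update G′ c d false) a b true x y (x≢a ∘ proj₁)) (trans
            (update-other G′ c d false x y (x≢c ∘ proj₁)) (trans (sym (moved x y)) (moveCross-other x y (x≢a ∘ proj₁) (x≢c ∘ proj₁))))

  findQ-full : ∀ G r s f y → s ≤ y → y < findQ G r s f → G r y ≡ true
  findQ-full G r s zero y s≤y y< = ⊥-elim (<⇒≱ y< s≤y)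
  findQ-full G r s (suc f) y s≤y y< with G r s in e
  ... | false = ⊥-elim (<⇒≱ y< s≤y)
  ... | true with s ≟ y
  ...   | yes refl = e
  ...   | no s≢y = findQ-full G r (suc s) f y (≤∧≢⇒< s≤y s≢y) y<

  findQ-≥ : ∀ G r s f → s ≤ findQ G r s f
  findQ-≥ G r s zero = ≤-refl
  findQ-≥ G r s (suc f) with G r s
  ... | true = <⇒≤ (findQ-≥ G r (suc s) f)
  ... | false = ≤-refl

  findQ-stops : ∀ G r s f → G r (findQ G r s f) ≡ false ⊎ findQ G r s f ≡ s + f
  findQ-stops G r s zero = inj₂ (sym (+-identityʳ s))
  findQ-stops G r s (suc f) with G r s in e
  ... | false = inj₁ e
  ... | true with findQ-stops G r (suc s) f
  ...   | inj₁ x = inj₁ x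
  ...   | inj₂ x = inj₂ (trans x (sym (+-suc s f)))

  findQ-≡ : ∀ G r s f t → (∀ y → s ≤ y → y < t → G r y ≡ true) → G r t ≡ false → s ≤ t → t ≤ s + f → findQ G r s f ≡ t
  findQ-≡ G r s zero t _ _ s≤t t≤ = ≤-antisym s≤t (subst (t ≤_) (+-identityʳ s) t≤)
  findQ-≡ G r s (suc f) t full Grt s≤t t≤ with s ≟ t
  ... | yes refl rewrite Grt = refl
  ... | no s≢t rewrite full s ≤-refl (≤∧≢⇒< s≤t s≢t) =
    findQ-≡ G r (suc s) f t (λ y s<y y<t → full y (<⇒≤ s<y) y<t) Grt (≤∧≢⇒< s≤t s≢t) (subst (t ≤_) (+-suc s f) t≤)

  allCross-false : ∀ G i y j → G i y ≡ false → 1 ≤ y → y ≤ j → allCross G i j ≡ false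
  allCross-false G i y zero _ 1≤y y≤j = ⊥-elim (<⇒≱ 1≤y y≤j)
  allCross-false G i y (suc j) g 1≤y y≤j with y ≟ suc j
  ... | yes refl rewrite g = refl
  ... | no y≢ rewrite allCross-false G i y j g 1≤y (≤-pred (≤∧≢⇒< y≤j y≢)) = ∧-zeroʳ (G i (suc j))

  ≤∸1⇒< : ∀ {c j} → 1 ≤ j → c ≤ j ∸ 1 → c < j
  ≤∸1⇒< {j = suc j} _ c≤j = s≤s c≤j

  <⇒≤∸1 : ∀ {z j} → z < j → z ≤ j ∸ 1
  <⇒≤∸1 {j = suc j} (s≤s z≤j) = z≤j

  BothFull : Grid → ℕ → ℕ → ℕ → Set
  BothFull G i c m = ∀ y → c < y → y ≤ m → (G i y ≡ true) × (G (suc i) y ≡ true)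

  scanLeft-≡ : ∀ G i m c → BothFull G i c m → G i c ≡ false → G (suc i) c ≡ false → 1 ≤ c → c ≤ m →
    scanLeft G i m ≡ just c
  scanLeft-≡ G i zero c _ _ _ 1≤c c≤m = ⊥-elim (<⇒≱ 1≤c c≤m)
  scanLeft-≡ G i (suc m) c full g₁ g₂ 1≤c c≤m with c ≟ suc m
  ... | yes refl rewrite g₁ | g₂ = refl
  ... | no c≢ rewrite proj₁ (full (suc m) (≤∧≢⇒< c≤m c≢) ≤-refl) | proj₂ (full (suc m) (≤∧≢⇒< c≤m c≢) ≤-refl) =
    scanLeft-≡ G i m c (λ y c<y y≤m → full y c<y (≤-trans y≤m (n≤1+n m))) g₁ g₂ 1≤c (≤-pred (≤∧≢⇒< c≤m c≢))

  record ScanResult (G : Grid) (i m c : ℕ) : Set where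
    field
      1≤c  : 1 ≤ c
      c≤m  : c ≤ m
      ↑c   : G i c ≡ false
      ↓c   : G (suc i) c ≡ false
      full : BothFull G i c m

  scanLeft-just : ∀ G i m c → scanLeft G i m ≡ just c → ScanResult G i m c
  scanLeft-just G i (suc m) c e with G i (suc m) in e₁ | G (suc i) (suc m) in e₂
  scanLeft-just G i (suc m) c refl | false | false = record
    { 1≤c = s≤s z≤n ; c≤m = ≤-refl ; ↑c = e₁ ; ↓c = e₂ ; full = λ y c<y y≤m → ⊥-elim (<⇒≱ c<y y≤m) }
  scanLeft-just G i (suc m) c e | true | true = record
    { 1≤c = 1≤c ; c≤m = ≤-trans c≤m (n≤1+n m) ; ↑c = ↑c ; ↓c = ↓c ; full = full′ }
    where
    open ScanResult (scanLeft-just G i m c e)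
    full′ : BothFull G i c (suc m)
    full′ y c<y y≤ with y ≟ suc m
    ... | yes refl = e₁ , e₂
    ... | no y≢ = full y c<y (≤-pred (≤∧≢⇒< y≤ y≢))

  eMove-just : ∀ n i D ℓ → lastL (proj₂ (pairing n D i)) ≡ just ℓ →
    eMove n i D ≡ just (moveCross D (suc i , ℓ) (i , findQ D (suc i) (suc ℓ) (suc n)))
  eMove-just n i D ℓ ℓ-rightmost rewrite ℓ-rightmost = refl

  fMove-just : ∀ n i D j c → lastL (proj₁ (pairing n D i)) ≡ just j → allCross D i j ≡ false →
    scanLeft D i (j ∸ 1) ≡ just c → fMove n i D ≡ just (moveCross D (i , j) (suc i , c))
  fMove-just n i D j c j-leftmost not-all scan rewrite j-leftmost | not-all | scan = refl

  wt-shift : ∀ n i (D E : Grid) →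
    length (rowCrosses n E i) ≡ suc (length (rowCrosses n D i)) →
    suc (length (rowCrosses n E (suc i))) ≡ length (rowCrosses n D (suc i)) →
    (∀ r → r ≢ i → r ≢ suc i → rowCrosses n E r ≡ rowCrosses n D r) →
    ∀ k → wt n E k ≡ wt n D k +ℤ α n i k
  wt-shift n i D E up down others k with suc (toℕ k) ≟ i | suc (toℕ k) ≟ suc i
  ... | yes refl | _ rewrite ≡ᵇ-refl (suc (toℕ k)) | up = cong ℤ.+_ (+-comm 1 _)
  ... | no r≢i | yes refl rewrite ≡ᵇ-false r≢i | ≡ᵇ-refl (suc (suc (toℕ k))) | sym down = refl
  ... | no r≢i | no r≢si rewrite ≡ᵇ-false r≢i | ≡ᵇ-false r≢si | others (suc (toℕ k)) r≢i r≢si =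
    cong ℤ.+_ (sym (+-identityʳ _))

  no-cross-beyond-n : ∀ {n D x y} → IsPipeDream n D → n < y → D x y ≡ false
  no-cross-beyond-n {n} {D} {x} {y} D-pd n<y with D x y in Dxy
  ... | false = refl
  ... | true = ⊥-elim (<⇒≱ n<y (≤-trans (m≤n+m y x) (proj₂ (proj₂ (D-pd x y Dxy)))))

  module Raising (n i₀ : ℕ) (D : Grid) (D-pd : IsPipeDream n D) (D-reduced : Reduced n D) (ℓ : ℕ)
    (ℓ-rightmost : lastL (proj₂ (pairing n D (suc i₀))) ≡ just ℓ) where

    i : ℕ
    i = suc i₀

    U V : List ℕ
    U = rowCrosses n D i
    V = rowCrosses n D (suc i)

    ℓ-unpaired : ℓ ∈ unpairedLower (reverse U) V
    ℓ-unpaired = lastL-∈ _ ℓ-rightmost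

    ℓ∈V : ℓ ∈ V
    ℓ∈V = unpairedLower-⊆ (reverse U) V (rowCrosses-Asc n D (suc i)) ℓ-unpaired

    D↓ℓ : D (suc i) ℓ ≡ true
    D↓ℓ = proj₁ (∈-rowCrosses⁻ n D (suc i) ℓ∈V)

    1≤ℓ : 1 ≤ ℓ
    1≤ℓ = proj₁ (proj₂ (∈-rowCrosses⁻ n D (suc i) ℓ∈V))

    k : ℕ
    k = findQ D (suc i) (suc ℓ) (suc n) ∸ suc ℓ

    q : ℕ
    q = suc ℓ + k

    q≡findQ : q ≡ findQ D (suc i) (suc ℓ) (suc n)
    q≡findQ = m+[n∸m]≡n (findQ-≥ D (suc i) (suc ℓ) (suc n))

    ℓ<q : ℓ < q
    ℓ<q = s≤s (m≤m+n ℓ k)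

    D↓mid : ∀ y → ℓ < y → y < q → D (suc i) y ≡ true
    D↓mid y ℓ<y y<q = findQ-full D (suc i) (suc ℓ) (suc n) y ℓ<y (subst (y <_) q≡findQ y<q)

    D↓q : D (suc i) q ≡ false
    D↓q with findQ-stops D (suc i) (suc ℓ) (suc n)
    ... | inj₁ stop = trans (cong (D (suc i)) q≡findQ) stop
    ... | inj₂ q≡ = no-cross-beyond-n D-pd (subst (n <_) (sym (trans q≡findQ q≡))
                      (≤-trans (s≤s (m≤n+m n (suc ℓ))) (≤-reflexive (sym (+-suc (suc ℓ) n)))))

    i+q≤n : i + q ≤ n
    i+q≤n = subst (_≤ n) (sym (+-suc i (ℓ + k))) (proj₂ (proj₂ (D-pd (suc i) (ℓ + k) last-cross)))
      where last-cross : D (suc i) (ℓ + k) ≡ true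
            last-cross with ℓ ≟ ℓ + k
            ... | yes ℓ≡ = subst (λ y → D (suc i) y ≡ true) ℓ≡ D↓ℓ
            ... | no ℓ≢ = D↓mid (ℓ + k) (≤∧≢⇒< (m≤m+n ℓ k) ℓ≢) ≤-refl

    q≤n : q ≤ n
    q≤n = ≤-trans (m≤n+m q i) i+q≤n

    D↑ℓ : D i ℓ ≡ false
    D↑ℓ with D i ℓ in D↑ℓ
    ... | false = refl
    ... | true = ⊥-elim (unpairedLower∉upper (reverse U) V ℓ (rowCrosses-Asc n D (suc i)) ℓ-unpaired
                   (reverse⁺ (∈-rowCrosses⁺ D i D↑ℓ 1≤ℓ (<⇒≤ (<-≤-trans ℓ<q q≤n)))))

    D↑mid : ∀ y → ℓ < y → y < q → D i y ≡ true
    D↑mid y ℓ<y y<q = proj₁ (∈-rowCrosses⁻ n D i (reverse⁻ (Gap.upper-full ℓ q (reverse U) V (suc n)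
      (reverse-Asc U (rowCrosses-Asc n D i)) (rowCrosses-Asc n D (suc i))
      (λ p → s≤s (proj₂ (proj₂ (∈-rowCrosses⁻ n D i (reverse⁻ p)))))
      (λ {z} ℓ<z z<q _ → ∈-rowCrosses⁺ D (suc i) (D↓mid z ℓ<z z<q) (≤-trans (s≤s z≤n) ℓ<z) (<⇒≤ (<-≤-trans z<q q≤n)))
      ℓ-unpaired (lastL-max _ (unpairedLower-Asc (reverse U) V (rowCrosses-Asc n D (suc i))) ℓ-rightmost)
      ℓ<y y<q (s≤s (<⇒≤ (<-≤-trans y<q q≤n))))))

    D↑q : D i q ≡ false
    D↑q = CornerCross.no-corner-cross n i₀ ℓ k D D-pd D-reduced 1≤ℓ q≤n D↑ℓ D↑mid D↓ℓ D↓mid D↓q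

    E : Grid
    E = moveCross D (suc i , ℓ) (i , q)

    eMove≡ : eMove n i D ≡ just E
    eMove≡ = trans (eMove-just n i D ℓ ℓ-rightmost) (cong (λ t → just (moveCross D (suc i , ℓ) (i , t))) (sym q≡findQ))

    open MoveCross D (suc i) ℓ i q 1+n≢n

    E↑ : ∀ y → y ≢ q → E i y ≡ D i y
    E↑ = moveCross-target-row

    E↓ : ∀ y → y ≢ ℓ → E (suc i) y ≡ D (suc i) y
    E↓ = moveCross-source-row

    chute : ChuteMove n i ℓ k D E
    chute = record
      { 1≤ℓ = 1≤ℓ ; q≤n = q≤n
      ; agree = λ x y out → sym (moveCross-other x y
          (λ { (refl , refl) → out (inj₂ refl , ≤-refl , <⇒≤ ℓ<q) })
          (λ { (refl , refl) → out (inj₁ refl , <⇒≤ ℓ<q , ≤-refl) }))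
      ; G↑ℓ = D↑ℓ ; G↑mid = D↑mid ; G↑q = D↑q ; G↓ℓ = D↓ℓ ; G↓mid = D↓mid ; G↓q = D↓q
      ; H↑ℓ = trans (E↑ ℓ (<⇒≢ ℓ<q)) D↑ℓ
      ; H↑mid = λ y ℓ<y y<q → trans (E↑ y (<⇒≢ y<q)) (D↑mid y ℓ<y y<q)
      ; H↑q = moveCross-target
      ; H↓ℓ = moveCross-source
      ; H↓mid = λ y ℓ<y y<q → trans (E↓ y (>⇒≢ ℓ<y)) (D↓mid y ℓ<y y<q)
      ; H↓q = trans (E↓ q (>⇒≢ ℓ<q)) D↓q
      }

    open ChuteMove chute using (H↑ℓ; H↑mid; H↑q; H↓ℓ; H↓mid)

    E-pd : IsPipeDream n E
    E-pd x y Exy with x ≟ i | y ≟ q | x ≟ suc i | y ≟ ℓ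
    ... | yes refl | yes refl | _ | _ = s≤s z≤n , ≤-trans (s≤s z≤n) ℓ<q , i+q≤n
    ... | _ | _ | yes refl | yes refl with () ← trans (sym Exy) H↓ℓ
    ... | yes refl | no y≢q | _ | _ = D-pd x y (trans (sym (E↑ y y≢q)) Exy)
    ... | no x≢i | _ | no x≢si | _ = D-pd x y (trans (sym (moveCross-other x y (x≢si ∘ proj₁) (x≢i ∘ proj₁))) Exy)
    ... | no x≢i | _ | yes refl | no y≢ℓ = D-pd x y (trans (sym (E↓ y y≢ℓ)) Exy)

    E∈RP : ∀ w → InRP n w D → InRP n w E
    E∈RP w (_ , exits , reduced) =
      E-pd ,
      (λ a → trans (sym (exit-preserved (suc (toℕ a)) (toℕ<n a))) (exits a)) ,
      (λ a b a≢b → subst (_≤ 1) (crossings-preserved (suc (toℕ a)) (suc (toℕ b)) (toℕ<n a) (toℕ<n b)) (reduced a b a≢b))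
      where open ChuteInvariance chute

    E-upper : rowCrosses n E i ≡ insA q U
    E-upper = rowCrosses-insA n D E i q H↑q D↑q E↑ (≤-trans (s≤s z≤n) ℓ<q) q≤n

    E-lower : V ≡ insA ℓ (rowCrosses n E (suc i))
    E-lower = rowCrosses-insA n E D (suc i) ℓ D↓ℓ H↓ℓ (λ y y≢ℓ → sym (E↓ y y≢ℓ)) 1≤ℓ (<⇒≤ (<-≤-trans ℓ<q q≤n))

    wt-E : ∀ k → wt n E k ≡ wt n D k +ℤ α n i k
    wt-E = wt-shift n i D E
      (trans (cong length E-upper) (length-insA q U))
      (sym (trans (cong length E-lower) (length-insA ℓ (rowCrosses n E (suc i)))))
      (λ r r≢i r≢si → rowCrosses-cong n E D r (λ y → moveCross-other r y (r≢si ∘ proj₁) (r≢i ∘ proj₁)))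

    fMove-undoes : ∀ D′ → E ≐ D′ → fMove n i D′ ↦ D
    fMove-undoes D′ E≐D′ = subst (_↦ D) (sym (fMove-just n i D′ q ℓ q-leftmost′ not-all-crosses scan))
      (moveCross-undo D↓ℓ D↑q E≐D′)
      where
      D′≐E : ∀ x y → D′ x y ≡ E x y
      D′≐E x y = sym (E≐D′ x y)
      Y = rowCrosses n E (suc i)
      q-leftmost : lastL (unpairedUpper (reverse (insA q U)) Y) ≡ just q
      q-leftmost = AfterRaising.leftmostUnpairedUpper U Y ℓ q (rowCrosses-Asc n D i) (rowCrosses-Asc n E (suc i))
        (∉-rowCrosses {n} E (suc i) H↓ℓ) (∉-rowCrosses {n} D i D↑q) ℓ<q (subst (λ W → lastL (unpairedLower (reverse U) W) ≡ just ℓ) E-lower ℓ-rightmost)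
        (λ {z} ℓ<z z<q → ∈-rowCrosses⁺ E (suc i) (H↓mid z ℓ<z z<q) (≤-trans (s≤s z≤n) ℓ<z) (<⇒≤ (<-≤-trans z<q q≤n)))
      q-leftmost′ : lastL (proj₁ (pairing n D′ i)) ≡ just q
      q-leftmost′ = subst₂ (λ A B → lastL (unpairedUpper (reverse A) B) ≡ just q)
        (sym (trans (rowCrosses-cong n D′ E i (D′≐E i)) E-upper)) (sym (rowCrosses-cong n D′ E (suc i) (D′≐E (suc i)))) q-leftmost
      not-all-crosses : allCross D′ i q ≡ false
      not-all-crosses = allCross-false D′ i ℓ q (trans (D′≐E i ℓ) H↑ℓ) 1≤ℓ (<⇒≤ ℓ<q)
      scan : scanLeft D′ i (q ∸ 1) ≡ just ℓ
      scan = scanLeft-≡ D′ i (ℓ + k) ℓ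
        (λ y ℓ<y y≤ → trans (D′≐E i y) (H↑mid y ℓ<y (s≤s y≤)) , trans (D′≐E (suc i) y) (H↓mid y ℓ<y (s≤s y≤)))
        (trans (D′≐E i ℓ) H↑ℓ) (trans (D′≐E (suc i) ℓ) H↓ℓ) 1≤ℓ (m≤m+n ℓ k)

  module Lowering (n i₀ : ℕ) (D D′ : Grid) (j c : ℕ)
    (j-leftmost : lastL (proj₁ (pairing n D′ (suc i₀))) ≡ just j)
    (scan : scanLeft D′ (suc i₀) (j ∸ 1) ≡ just c)
    (moved : moveCross D′ (suc i₀ , j) (suc (suc i₀) , c) ≐ D) where

    i : ℕ
    i = suc i₀

    U′ Y X : List ℕ
    U′ = rowCrosses n D′ i
    Y = rowCrosses n D′ (suc i)
    X = rowCrosses n D i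

    open ScanResult (scanLeft-just D′ i (j ∸ 1) c scan)
    open MoveCross D′ i j (suc i) c (1+n≢n ∘ sym)

    j-unpaired : j ∈ unpairedUpper (reverse U′) Y
    j-unpaired = lastL-∈ _ j-leftmost

    j∈U′ : j ∈ U′
    j∈U′ = reverse⁻ (unpairedUpper-⊆ (reverse U′) Y j-unpaired)

    D′↑j : D′ i j ≡ true
    D′↑j = proj₁ (∈-rowCrosses⁻ n D′ i j∈U′)

    1≤j : 1 ≤ j
    1≤j = proj₁ (proj₂ (∈-rowCrosses⁻ n D′ i j∈U′))

    j≤n : j ≤ n
    j≤n = proj₂ (proj₂ (∈-rowCrosses⁻ n D′ i j∈U′))

    c<j : c < j
    c<j = ≤∸1⇒< 1≤j c≤m

    D↑ : ∀ y → y ≢ j → D i y ≡ D′ i y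
    D↑ y y≢j = trans (sym (moved i y)) (moveCross-source-row y y≢j)

    D↓ : ∀ y → y ≢ c → D (suc i) y ≡ D′ (suc i) y
    D↓ y y≢c = trans (sym (moved (suc i) y)) (moveCross-target-row y y≢c)

    D↑j : D i j ≡ false
    D↑j = trans (sym (moved i j)) moveCross-source

    D↓c : D (suc i) c ≡ true
    D↓c = trans (sym (moved (suc i) c)) moveCross-target

    U′≡ : U′ ≡ insA j X
    U′≡ = rowCrosses-insA n D D′ i j D′↑j D↑j (λ y y≢j → sym (D↑ y y≢j)) 1≤j j≤n

    D-lower≡ : rowCrosses n D (suc i) ≡ insA c Y
    D-lower≡ = rowCrosses-insA n D′ D (suc i) c D↓c ↓c D↓ 1≤c (<⇒≤ (<-≤-trans c<j j≤n))

    c-rightmost : lastL (proj₂ (pairing n D i)) ≡ just c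
    c-rightmost = subst (λ B → lastL (unpairedLower (reverse X) B) ≡ just c) (sym D-lower≡)
      (AfterLowering.rightmostUnpairedLower X Y j c (rowCrosses-Asc n D i) (rowCrosses-Asc n D′ (suc i))
        (∉-rowCrosses {n} D i D↑j) (∉-rowCrosses {n} D i (trans (D↑ c (<⇒≢ c<j)) ↑c)) (∉-rowCrosses {n} D′ (suc i) ↓c) c<j
        (subst (λ A → lastL (unpairedUpper (reverse A) Y) ≡ just j) U′≡ j-leftmost)
        (λ {z} c<z z<j → ∈-rowCrosses⁺ D i (trans (D↑ z (<⇒≢ z<j)) (proj₁ (full z c<z (<⇒≤∸1 z<j))))
                           (≤-trans (s≤s z≤n) c<z) (<⇒≤ (<-≤-trans z<j j≤n))))

    D′↓j : D′ (suc i) j ≡ false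
    D′↓j with D′ (suc i) j in D′↓j
    ... | false = refl
    ... | true = ⊥-elim (unpairedUpper∉lower (reverse U′) Y j (reverse-Asc U′ (rowCrosses-Asc n D′ i))
                   (rowCrosses-Asc n D′ (suc i)) j-unpaired (∈-rowCrosses⁺ D′ (suc i) D′↓j 1≤j j≤n))

    findQ≡j : findQ D (suc i) (suc c) (suc n) ≡ j
    findQ≡j = findQ-≡ D (suc i) (suc c) (suc n) j
      (λ y c<y y<j → trans (D↓ y (>⇒≢ c<y)) (proj₂ (full y c<y (<⇒≤∸1 y<j))))
      (trans (D↓ j (>⇒≢ c<j)) D′↓j) c<j (≤-trans j≤n (≤-trans (n≤1+n n) (m≤n+m (suc n) (suc c))))

    eMove-undoes : eMove n i D ↦ D′
    eMove-undoes = subst (_↦ D′) (sym eMove≡) (moveCross-undo D′↑j ↓c moved)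
      where eMove≡ : eMove n i D ≡ just (moveCross D (suc i , c) (i , j))
            eMove≡ = trans (eMove-just n i D c c-rightmost) (cong (λ t → just (moveCross D (suc i , c) (i , t))) findQ≡j)

  raising-candidate : ∀ n i D → eMove n i D ≡ nothing ⊎ Σ ℕ λ ℓ → lastL (proj₂ (pairing n D i)) ≡ just ℓ
  raising-candidate n i D with lastL (proj₂ (pairing n D i))
  ... | nothing = inj₁ refl
  ... | just ℓ = inj₂ (ℓ , refl)

  lowering-candidate : ∀ n i D′ → fMove n i D′ ≡ nothing ⊎
    Σ ℕ λ j → Σ ℕ λ c → (lastL (proj₁ (pairing n D′ i)) ≡ just j) × (scanLeft D′ i (j ∸ 1) ≡ just c) ×
      (fMove n i D′ ≡ just (moveCross D′ (i , j) (suc i , c)))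
  lowering-candidate n i D′ with lastL (proj₁ (pairing n D′ i))
  ... | nothing = inj₁ refl
  ... | just j with allCross D′ i j
  ...   | true = inj₁ refl
  ...   | false with scanLeft D′ i (j ∸ 1) in scan
  ...     | nothing = inj₁ refl
  ...     | just c = inj₂ (j , c , refl , scan , refl)

  module _ (n : ℕ) (w : Permutation′ n) (i₀ : ℕ) where

    raise-preserves-RP : ∀ D E → InRP n w D → eMove n (suc i₀) D ≡ just E →
      InRP n w E × (∀ k → wt n E k ≡ wt n D k +ℤ α n (suc i₀) k)
    raise-preserves-RP D E D∈RP@(D-pd , _ , D-reduced) raised with raising-candidate n (suc i₀) D
    ... | inj₁ none with () ← trans (sym raised) none
    ... | inj₂ (ℓ , ℓ-rightmost) = subst (λ G → InRP n w G × (∀ k → wt n G k ≡ wt n D k +ℤ α n (suc i₀) k))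
                                      (just-injective (trans (sym eMove≡) raised)) (E∈RP w D∈RP , wt-E)
      where open Raising n i₀ D D-pd D-reduced ℓ ℓ-rightmost using (eMove≡; E∈RP; wt-E)

    raise⇒lower : ∀ D D′ → InRP n w D → eMove n (suc i₀) D ↦ D′ → fMove n (suc i₀) D′ ↦ D
    raise⇒lower D D′ (D-pd , _ , D-reduced) raised with raising-candidate n (suc i₀) D
    ... | inj₁ none = ⊥-elim (subst (_↦ D′) none raised)
    ... | inj₂ (ℓ , ℓ-rightmost) = fMove-undoes D′ (subst (_↦ D′) eMove≡ raised)
      where open Raising n i₀ D D-pd D-reduced ℓ ℓ-rightmost using (eMove≡; fMove-undoes)

    lower⇒raise : ∀ D D′ → fMove n (suc i₀) D′ ↦ D → eMove n (suc i₀) D ↦ D′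
    lower⇒raise D D′ lowered with lowering-candidate n (suc i₀) D′
    ... | inj₁ none = ⊥-elim (subst (_↦ D) none lowered)
    ... | inj₂ (j , c , j-leftmost , scan , fMove≡) =
      Lowering.eMove-undoes n i₀ D D′ j c j-leftmost scan (subst (_↦ D) fMove≡ lowered)

open import Data.Nat using (ℕ; suc; _≤_; _<_)
open import Data.Integer using (_+_)
open import Data.Fin using (Fin)
open import Data.Fin.Permutation using (Permutation′)
open import Data.Maybe using (just)
open import Data.Product using (_×_; _,_)
open import Function.Bundles using (_⇔_; mk⇔)
open import Relation.Binary.PropositionalEquality using (_≡_)

proposition2p11 : (n : ℕ) (w : Permutation′ n) (i : ℕ) → 1 ≤ i → i < n →
    (∀ (D E : Grid) → InRP n w D → eMove n i D ≡ just E →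
    InRP n w E × (∀ (k : Fin n) → wt n E k ≡ wt n D k + α n i k))
    × (∀ (D D′ : Grid) → InRP n w D → InRP n w D′ →
    (eMove n i D ↦ D′) ⇔ (fMove n i D′ ↦ D))
proposition2p11 n w (suc i₀) _ _ =
  raise-preserves-RP n w i₀ , λ D D′ D∈RP _ → mk⇔ (raise⇒lower n w i₀ D D′ D∈RP) (lower⇒raise n w i₀ D D′)
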